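{- Let $F$ be an unsatisfiable formula and $\gamma\in F$ a clause such that $F\setminus\{\gamma\}$ is satisfiable, let $x$ be a new variable not in $F$, and let $g_x(F)=\{x,\ \neg x\vee\gamma\}\cup (F\setminus\{\gamma\})$. Then every optimal (minimum-size) regular resolution proof of $g_x(F)$ contains exactly one resolution step on the variable $x$, and this step can be pushed to the leaves, i.e., there is an optimal regular resolution proof of $g_x(F)$ whose unique resolution step on $x$ resolves the leaf clauses $x$ and $\neg x\vee\gamma$.
   Context: Resolution: from clauses $\gamma\vee x$ and $\delta\vee\neg x$ derive the resolvent $\gamma\vee\delta$ (resolving on $x$). A resolution proof of a formula $F$ is a directed acyclic graph whose nodes are clauses, whose leaves are clauses of $F$, in which each internal node is the resolvent of its two children, and whose root is the empty clause. It is regular if no path from the root to a leaf contains two resolution steps on the same variable. The size of a proof is its number of nodes; an optimal proof has minimum size. -}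

module Defs where

open import Data.Nat using (ℕ; suc; _≤_)
open import Data.Bool using (Bool; true; false)
open import Data.Fin using (Fin; fromℕ; toℕ) renaming (_<_ to _<ᶠ_)
open import Data.List using (List; []; _∷_)
open import Data.List.Membership.Propositional using (_∈_)
open import Data.List.Relation.Unary.Any using (Any)
open import Data.List.Relation.Unary.Unique.Propositional using (Unique)
open import Data.Product using (Σ; ∃; ∃-syntax; _×_; _,_; proj₁; proj₂)
open import Data.Sum using (_⊎_)
open import Relation.Nullary using (¬_)
open import Relation.Binary.PropositionalEquality using (_≡_; _≢_)

Var : Set
Var = ℕ

record Lit : Set where
  constructor lit
  field
    var : Var
    pol : Bool      -- true = positive literal x, false = negative literal ¬x
open Lit public

pos neg : Var → Lit
pos x = lit x true
neg x = lit x false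

-- A clause is a finite set of literals, represented by a list;
-- two clauses are equal iff they have the same elements.
Clause : Set
Clause = List Lit

_≐_ : Clause → Clause → Set
C ≐ D = (∀ l → l ∈ C → l ∈ D) × (∀ l → l ∈ D → l ∈ C)

CNF : Set
CNF = List Clause

ClauseSet : Set₁
ClauseSet = Clause → Set

⟦_⟧ : CNF → ClauseSet
⟦ F ⟧ C = Σ Clause λ D → D ∈ F × C ≐ D

_∖_ : CNF → Clause → ClauseSet
(F ∖ γ) C = Σ Clause λ D → D ∈ F × ¬ (D ≐ γ) × C ≐ D

g : Var → CNF → Clause → ClauseSet
g x F γ C = C ≐ (pos x ∷ []) ⊎ C ≐ (neg x ∷ γ) ⊎ (F ∖ γ) C

Assignment : Set
Assignment = Var → Bool

_⊨ˡ_ : Assignment → Lit → Set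
α ⊨ˡ l = α (var l) ≡ pol l

_⊨ᶜ_ : Assignment → Clause → Set
α ⊨ᶜ C = Any (α ⊨ˡ_) C

Satisfiable : ClauseSet → Set
Satisfiable S = ∃[ α ] (∀ C → S C → α ⊨ᶜ C)

Unsatisfiable : ClauseSet → Set
Unsatisfiable S = ¬ Satisfiable S

NotIn : Var → CNF → Set
NotIn x F = ∀ C → C ∈ F → ∀ l → l ∈ C → var l ≢ x

-- Resolution proofs as DAGs.
-- A proof of size n has nodes 0 … n-1; node (n-1) is the root.
-- Every internal node points to two children with smaller index
-- (so the graph is acyclic).

data Kind (n : ℕ) : Set where
  leaf : Kind n
  -- res x j k : resolvent of node j (containing x) and node k (containing ¬x)
  res  : Var → Fin n → Fin n → Kind n

record Node (n : ℕ) : Set where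
  constructor node
  field
    clause : Clause
    kind   : Kind n
open Node public

IsResolvent : Var → Clause → Clause → Clause → Set
IsResolvent x C D E =
  pos x ∈ C × neg x ∈ D ×
  (∀ l → l ∈ E → (l ∈ C × l ≢ pos x) ⊎ (l ∈ D × l ≢ neg x)) ×
  (∀ l → (l ∈ C × l ≢ pos x) ⊎ (l ∈ D × l ≢ neg x) → l ∈ E)

NodeOK : ∀ {n} → ClauseSet → (Fin n → Node n) → Fin n → Kind n → Set
NodeOK S N i leaf = S (clause (N i))
NodeOK S N i (res x j k) =
  j <ᶠ i × k <ᶠ i × IsResolvent x (clause (N j)) (clause (N k)) (clause (N i))

-- i is a child of some node (so every node is reachable from the root)
HasParent : ∀ {n} → (Fin n → Node n) → Fin n → Set
HasParent N i = ∃[ p ] ∃[ x ] ∃[ j ] ∃[ k ]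
  (kind (N p) ≡ res x j k × (i ≡ j ⊎ i ≡ k))

record Proof (S : ClauseSet) : Set where
  field
    m      : ℕ
    nodes  : Fin (suc m) → Node (suc m)
    ok     : ∀ i → NodeOK S nodes i (kind (nodes i))
    root-empty : clause (nodes (fromℕ m)) ≡ []
    connected  : ∀ i → i ≢ fromℕ m → HasParent nodes i
open Proof public

size : ∀ {S} → Proof S → ℕ
size P = suc (m P)

root : ∀ {S} (P : Proof S) → Fin (size P)
root P = fromℕ (m P)

data Path {S} (P : Proof S) : Fin (size P) → List Var → Set where
  stop  : ∀ {i} → kind (nodes P i) ≡ leaf → Path P i []
  left  : ∀ {i x j k vs} → kind (nodes P i) ≡ res x j k →
          Path P j vs → Path P i (x ∷ vs)
  right : ∀ {i x j k vs} → kind (nodes P i) ≡ res x j k →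
          Path P k vs → Path P i (x ∷ vs)

Regular : ∀ {S} → Proof S → Set
Regular P = ∀ vs → Path P (root P) vs → Unique vs

OptimalRegular : ∀ {S} → Proof S → Set
OptimalRegular {S} P = Regular P × (∀ (Q : Proof S) → Regular Q → size P ≤ size Q)

ResOn : ∀ {S} (P : Proof S) → Var → Fin (size P) → Set
ResOn P x i = ∃[ j ] ∃[ k ] (kind (nodes P i) ≡ res x j k)

ExactlyOneResOn : ∀ {S} (P : Proof S) → Var → Set
ExactlyOneResOn P x = ∃[ i ] (ResOn P x i × (∀ i' → ResOn P x i' → i' ≡ i))

IsLeaf : ∀ {S} (P : Proof S) → Fin (size P) → Set
IsLeaf P i = kind (nodes P i) ≡ leaf

module Submission where

-- If α satisfies F ∖ γ, then α with x set to false satisfies every clause of g x F γ except the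
-- unit clause x, and a resolution step not on x turns clauses that contain x or are satisfied
-- into such a clause; as the empty clause is neither, every refutation resolves on x.
-- Conversely, restricting a regular refutation P by x = 1 deletes the nodes containing x and
-- short-circuits the steps on x; re-deriving γ by a single step from the leaves x and ¬x ∨ γ then
-- gives a regular refutation whose only step on x is at the leaves. Neither a step on x nor its
-- premise containing x survives, so it is no larger than P, and smaller if P resolves on x twice.

-- Optimal regular refutations exist constructively: splitting on all variables gives a regular
-- refutation, and since clauses can be normalised to sublists of a fixed list of literals, the
-- existence of a regular refutation of a given size is decidable.

open import Defs
open import Data.Bool using (Bool; true; false; not)
open import Data.Bool.Properties using (not-involutive; ¬-not) renaming (_≟_ to _≟ᵇ_)
open import Data.Empty using (⊥; ⊥-elim)
open import Data.Fin as Fin using (Fin; fromℕ; toℕ; punchIn; punchOut; opposite) renaming (zero to fz; suc to fs)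
open import Data.Fin.Properties as Finₚ using ()
open import Data.Fin.Induction using (<-wellFounded)
import Induction.WellFounded as WF
open import Data.List using (List; []; _∷_; _++_; length; map; concat; filter; allFin; cartesianProduct; deduplicate)
open import Data.List.Properties using (++-assoc; ≡-dec; filter-none)
open import Data.List.Membership.Propositional using (_∈_; _∉_; find; lose)
open import Data.List.Membership.Propositional.Properties using (∈-++⁺ˡ; ∈-++⁺ʳ; ∈-++⁻; ∈-map⁺; ∈-concat⁺′; ∈-allFin; ∈-cartesianProduct⁺; ∈-deduplicate⁺; ∈-filter⁺; ∈-filter⁻)
open import Data.List.Relation.Binary.Sublist.Propositional using ([]; _∷_; _∷ʳ_; minimum) renaming (_⊆_ to _⊑_)
open import Data.List.Relation.Binary.Sublist.Propositional.Properties using (Any-resp-⊆)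
open import Data.List.Relation.Unary.All as All using (All; []; _∷_)
open import Data.List.Relation.Unary.AllPairs as AllPairs using ([]; _∷_)
open import Data.List.Relation.Unary.Any as Any using (Any; here; there)
open import Data.List.Relation.Unary.Unique.Propositional using (Unique)
open import Data.Maybe using (Maybe; just; nothing; is-just)
open import Data.Nat as ℕ using (ℕ; zero; suc; _+_; _≤_; _<_; z≤n; s≤s; _∸_)
open import Data.Nat.Properties as ℕₚ using ()
open import Data.Product using (Σ; Σ-syntax; ∃-syntax; _×_; _,_; proj₁; proj₂; map₁; map₂; uncurry)
open import Data.Sum using (_⊎_; inj₁; inj₂; [_,_]′)
import Data.Sum as Sum
open import Data.Unit using (⊤; tt)
open import Data.Vec.Functional using (Vector; head; tail; removeAt; updateAt) renaming (_∷_ to _◃_)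
open import Data.Vec.Functional.Properties using (updateAt-minimal)
open import Function using (_∘_; const; case_of_)
open import Relation.Nullary using (¬_; Dec; yes; no; does)
open import Relation.Nullary.Decidable using (_×-dec_; _⊎-dec_; _→-dec_; ¬?; map′; isYes; decidable-stable)
open import Relation.Binary.PropositionalEquality
open import Algebra.Properties.CommutativeSemigroup ℕₚ.+-commutativeSemigroup using (x∙yz≈y∙xz)

_≟ˡ_ : (a b : Lit) → Dec (a ≡ b)
lit v p ≟ˡ lit w q with v ℕ.≟ w | p ≟ᵇ q
... | yes refl | yes refl = yes refl
... | no v≢w   | _        = no λ { refl → v≢w refl }
... | yes _    | no p≢q   = no λ { refl → p≢q refl }

open import Data.List.Membership.DecPropositional _≟ˡ_ using (_∈?_)
open import Data.List.Relation.Unary.Unique.DecPropositional.Properties ℕ._≟_ using (deduplicate-!)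

complement : Lit → Lit
complement (lit v b) = lit v (not b)

complement-involutive : ∀ l → complement (complement l) ≡ l
complement-involutive (lit v b) = cong (lit v) (not-involutive b)

_⊆ᶜ_ : Clause → Clause → Set
A ⊆ᶜ B = ∀ l → l ∈ A → l ∈ B

⊆ᶜ[]⇒≡[] : ∀ A → A ⊆ᶜ [] → A ≡ []
⊆ᶜ[]⇒≡[] []      _   = refl
⊆ᶜ[]⇒≡[] (l ∷ A) A⊆[] with () ← A⊆[] l (here refl)

≐-refl : ∀ {C} → C ≐ C
≐-refl = (λ _ l∈ → l∈) , (λ _ l∈ → l∈)

≐-sym : ∀ {C D} → C ≐ D → D ≐ C
≐-sym (C⊆D , D⊆C) = D⊆C , C⊆D

≐-trans : ∀ {C D E} → C ≐ D → D ≐ E → C ≐ E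
≐-trans (C⊆D , D⊆C) (D⊆E , E⊆D) = (λ l → D⊆E l ∘ C⊆D l) , (λ l → D⊆C l ∘ E⊆D l)

⊨ᶜ-mono : ∀ {α C D} → C ⊆ᶜ D → α ⊨ᶜ C → α ⊨ᶜ D
⊨ᶜ-mono C⊆D α⊨C = let l , l∈C , α⊨l = find α⊨C in lose (C⊆D l l∈C) α⊨l

remove : Lit → Clause → Clause
remove a [] = []
remove a (l ∷ A) with l ≟ˡ a
... | yes _ = remove a A
... | no  _ = l ∷ remove a A

∈-remove⁻ : ∀ {a l} A → l ∈ remove a A → l ∈ A × l ≢ a
∈-remove⁻ {a} (l′ ∷ A) l∈ with l′ ≟ˡ a | l∈
... | yes _   | l∈′       = map₁ there (∈-remove⁻ A l∈′)
... | no l′≢a | here refl = here refl , l′≢a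
... | no _    | there l∈′ = map₁ there (∈-remove⁻ A l∈′)

∈-remove⁺ : ∀ {a l} A → l ∈ A → l ≢ a → l ∈ remove a A
∈-remove⁺ {a} (l′ ∷ A) l∈ l≢a with l′ ≟ˡ a | l∈
... | yes refl | here refl = ⊥-elim (l≢a refl)
... | yes _    | there l∈′ = ∈-remove⁺ A l∈′ l≢a
... | no _     | here refl = here refl
... | no _     | there l∈′ = there (∈-remove⁺ A l∈′ l≢a)

resolvent : Var → Clause → Clause → Clause
resolvent y A B = remove (pos y) A ++ remove (neg y) B

resolvent-isResolvent : ∀ {y A B} → pos y ∈ A → neg y ∈ B → IsResolvent y A B (resolvent y A B)
resolvent-isResolvent {y} {A} {B} py∈A ny∈B = py∈A , ny∈B , sound , complete
  where
  sound : ∀ l → l ∈ resolvent y A B → (l ∈ A × l ≢ pos y) ⊎ (l ∈ B × l ≢ neg y)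
  sound l l∈ = Sum.map (∈-remove⁻ A) (∈-remove⁻ B) (∈-++⁻ (remove (pos y) A) l∈)
  complete : ∀ l → (l ∈ A × l ≢ pos y) ⊎ (l ∈ B × l ≢ neg y) → l ∈ resolvent y A B
  complete l (inj₁ (l∈A , l≢)) = ∈-++⁺ˡ (∈-remove⁺ A l∈A l≢)
  complete l (inj₂ (l∈B , l≢)) = ∈-++⁺ʳ (remove (pos y) A) (∈-remove⁺ B l∈B l≢)

resolvent-sound : ∀ {α y C D E} → IsResolvent y C D E → α ⊨ᶜ C → α ⊨ᶜ D → α ⊨ᶜ E
resolvent-sound {α} {y} (_ , _ , _ , complete) α⊨C α⊨D with find α⊨C | find α⊨D
... | l , l∈C , α⊨l | l′ , l′∈D , α⊨l′ with l ≟ˡ pos y | l′ ≟ˡ neg y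
...   | no l≢  | _       = lose (complete l (inj₁ (l∈C , l≢))) α⊨l
...   | yes _  | no l′≢  = lose (complete l′ (inj₂ (l′∈D , l′≢))) α⊨l′
...   | yes refl | yes refl with () ← trans (sym α⊨l) α⊨l′

module _ {y : Var} {C D E : Clause} (isRes : IsResolvent y C D E) where

  private
    sound = proj₁ (proj₂ (proj₂ isRes))
    complete = proj₂ (proj₂ (proj₂ isRes))

  ∉-resolvent : ∀ {l} → l ∉ C → l ∉ D → l ∉ E
  ∉-resolvent l∉C l∉D l∈E = [ l∉C ∘ proj₁ , l∉D ∘ proj₁ ]′ (sound _ l∈E)

  ⊆-resolventˡ : ∀ {A} → A ⊆ᶜ C → pos y ∉ A → A ⊆ᶜ E
  ⊆-resolventˡ {A} A⊆C py∉A l l∈A = complete l (inj₁ (A⊆C l l∈A , λ { refl → py∉A l∈A }))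

  ⊆-resolventʳ : ∀ {A} → A ⊆ᶜ D → neg y ∉ A → A ⊆ᶜ E
  ⊆-resolventʳ {A} A⊆D ny∉A l l∈A = complete l (inj₂ (A⊆D l l∈A , λ { refl → ny∉A l∈A }))

  resolvent-⊆ : ∀ {A B} → A ⊆ᶜ C → B ⊆ᶜ D → resolvent y A B ⊆ᶜ E
  resolvent-⊆ {A} {B} A⊆C B⊆D l l∈ with ∈-++⁻ (remove (pos y) A) l∈
  ... | inj₁ l∈A′ = let l∈A , l≢ = ∈-remove⁻ A l∈A′ in complete l (inj₁ (A⊆C l l∈A , l≢))
  ... | inj₂ l∈B′ = let l∈B , l≢ = ∈-remove⁻ B l∈B′ in complete l (inj₂ (B⊆D l l∈B , l≢))

resolvent-⊆ᶜ-++ : ∀ y A B → resolvent y A B ⊆ᶜ (A ++ B)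
resolvent-⊆ᶜ-++ y A B l l∈ with ∈-++⁻ (remove (pos y) A) l∈
... | inj₁ l∈A′ = ∈-++⁺ˡ (proj₁ (∈-remove⁻ A l∈A′))
... | inj₂ l∈B′ = ∈-++⁺ʳ A (proj₁ (∈-remove⁻ B l∈B′))

data Walk {n} (N : Fin n → Node n) : Fin n → List Var → Set where
  stop  : ∀ {i} → kind (N i) ≡ leaf → Walk N i []
  left  : ∀ {i y j k vs} → kind (N i) ≡ res y j k → Walk N j vs → Walk N i (y ∷ vs)
  right : ∀ {i y j k vs} → kind (N i) ≡ res y j k → Walk N k vs → Walk N i (y ∷ vs)

Path⇒Walk : ∀ {S} (P : Proof S) {i vs} → Path P i vs → Walk (nodes P) i vs
Path⇒Walk P (stop e)    = stop e
Path⇒Walk P (left e w)  = left e (Path⇒Walk P w)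
Path⇒Walk P (right e w) = right e (Path⇒Walk P w)

Walk⇒Path : ∀ {S} (P : Proof S) {i vs} → Walk (nodes P) i vs → Path P i vs
Walk⇒Path P (stop e)    = stop e
Walk⇒Path P (left e w)  = left e (Walk⇒Path P w)
Walk⇒Path P (right e w) = right e (Walk⇒Path P w)

Walk-leaf : ∀ {n} {N : Fin n → Node n} {i vs} → kind (N i) ≡ leaf → Walk N i vs → vs ≡ []
Walk-leaf isLeaf (stop _) = refl
Walk-leaf isLeaf (left e _) with () ← trans (sym isLeaf) e
Walk-leaf isLeaf (right e _) with () ← trans (sym isLeaf) e

Walk-resp-kind : ∀ {n} {N N′ : Fin n → Node n} → (∀ t → kind (N t) ≡ kind (N′ t)) → ∀ {i vs} → Walk N i vs → Walk N′ i vs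
Walk-resp-kind same {i} (stop e)    = stop (trans (sym (same i)) e)
Walk-resp-kind same {i} (left e w)  = left (trans (sym (same i)) e) (Walk-resp-kind same w)
Walk-resp-kind same {i} (right e w) = right (trans (sym (same i)) e) (Walk-resp-kind same w)

<-rec : ∀ {n} (P : Fin n → Set) → (∀ i → (∀ {c : Fin n} → c Fin.< i → P c) → P i) → ∀ i → P i
<-rec P = WF.All.wfRec <-wellFounded _ P

<-rec-unfold : ∀ {n} (P : Fin n → Set) (step : ∀ i → (∀ {c : Fin n} → c Fin.< i → P c) → P i) →
               (∀ i {h h′ : ∀ {c : Fin n} → c Fin.< i → P c} →
                  (∀ {c : Fin n} (c<i : c Fin.< i) → h c<i ≡ h′ c<i) → step i h ≡ step i h′) →
               ∀ i → <-rec P step i ≡ step i (λ {c : Fin n} _ → <-rec P step c)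
<-rec-unfold P step step-ext i = WF.FixPoint.unfold-wfRec <-wellFounded P step step-ext

NodeOK-res : ∀ {S n} (N : Fin n → Node n) → (∀ i → NodeOK S N i (kind (N i))) → ∀ {i y j k} → kind (N i) ≡ res y j k →
             j Fin.< i × k Fin.< i × IsResolvent y (clause (N j)) (clause (N k)) (clause (N i))
NodeOK-res {S} N ok {i} e = subst (NodeOK S N i) e (ok i)

bit : Bool → ℕ
bit true  = 1
bit false = 0

count : ∀ {n} → Vector Bool n → ℕ
count {zero}  f = 0
count {suc n} f = bit (head f) + count (tail f)

count≤n : ∀ {n} (f : Vector Bool n) → count f ≤ n
count≤n {zero}  f = z≤n
count≤n {suc n} f with head f
... | true  = s≤s (count≤n (tail f))
... | false = ℕₚ.m≤n⇒m≤1+n (count≤n (tail f))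

count-all : ∀ {n} (f : Vector Bool n) → (∀ t → f t ≡ true) → count f ≡ n
count-all {zero}  f all = refl
count-all {suc n} f all rewrite all fz = cong suc (count-all (tail f) (all ∘ fs))

count-removeAt : ∀ {n} (f : Vector Bool (suc n)) d → count f ≡ bit (f d) + count (removeAt f d)
count-removeAt f fz = refl
count-removeAt {suc n} f (fs d) = begin
  bit (f fz) + count (tail f)                           ≡⟨ cong (bit (f fz) +_) (count-removeAt (tail f) d) ⟩
  bit (f fz) + (bit (f (fs d)) + count (removeAt (tail f) d)) ≡⟨ x∙yz≈y∙xz (bit (f fz)) (bit (f (fs d))) _ ⟩
  bit (f (fs d)) + (bit (f fz) + count (removeAt (tail f) d)) ∎
  where open ≡-Reasoning

count-mark : ∀ {n} (f : Vector Bool n) a → f a ≡ false → suc (count f) ≡ count (updateAt f a (const true))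
count-mark f fz fa rewrite fa = refl
count-mark {suc n} f (fs a) fa =
  trans (sym (ℕₚ.+-suc (bit (head f)) _)) (cong (bit (head f) +_) (count-mark (tail f) a fa))

unmarked+count≤n : ∀ {n} (f : Vector Bool n) as → Unique as → All (λ a → f a ≡ false) as →
                   length as + count f ≤ n
unmarked+count≤n f []       _          _          = count≤n f
unmarked+count≤n {n} f (a ∷ as) (a∉as ∷ !as) (fa ∷ fas) = begin
  suc (length as + count f)  ≡⟨ sym (ℕₚ.+-suc (length as) _) ⟩
  length as + suc (count f)  ≡⟨ cong (length as +_) (count-mark f a fa) ⟩
  length as + count f′       ≤⟨ unmarked+count≤n f′ as !as (All.zipWith unmarked (a∉as , fas)) ⟩
  n                          ∎
  where
  open ℕₚ.≤-Reasoning
  f′ = updateAt f a (const true)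
  unmarked : ∀ {b} → a ≢ b × f b ≡ false → f′ b ≡ false
  unmarked {b} (a≢b , fb) = trans (updateAt-minimal b a f (a≢b ∘ sym)) fb

StepsOnLeaves : (Var → Set) → Clause → Clause → ∀ {n} → (Fin n → Node n) → Set
StepsOnLeaves Q c₁ c₂ N = ∀ i y j k → Q y → kind (N i) ≡ res y j k →
  (kind (N j) ≡ leaf × clause (N j) ≐ c₁) × (kind (N k) ≡ leaf × clause (N k) ≐ c₂)

ChildClosed : ∀ {n} → (Fin n → Node n) → Vector Bool n → Set
ChildClosed N K = ∀ i y j k → K i ≡ true → kind (N i) ≡ res y j k → K j ≡ true × K k ≡ true

NotChildIn : ∀ {n} → Fin n → Kind n → Set
NotChildIn d leaf        = ⊤
NotChildIn d (res y j k) = d ≢ j × d ≢ k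

notChildIn? : ∀ {n} (d : Fin n) κ → Dec (NotChildIn d κ)
notChildIn? d leaf        = yes tt
notChildIn? d (res y j k) = ¬? (d Finₚ.≟ j) ×-dec ¬? (d Finₚ.≟ k)

¬NotChildIn⇒HasParent : ∀ {n} (N : Fin n → Node n) {i} p → ¬ NotChildIn i (kind (N p)) → HasParent N i
¬NotChildIn⇒HasParent N {i} p child with kind (N p) in eq
... | leaf = ⊥-elim (child tt)
... | res y j k with i Finₚ.≟ j | i Finₚ.≟ k
...   | yes i≡j | _       = p , y , j , k , eq , inj₁ i≡j
...   | no _    | yes i≡k = p , y , j , k , eq , inj₂ i≡k
...   | no i≢j  | no i≢k  = ⊥-elim (child (i≢j , i≢k))

reindexKind : ∀ {n} (d : Fin (suc n)) (κ : Kind (suc n)) → NotChildIn d κ → Kind n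
reindexKind d leaf        _           = leaf
reindexKind d (res y j k) (d≢j , d≢k) = res y (punchOut d≢j) (punchOut d≢k)

reindexKind-res⁻ : ∀ {n} (d : Fin (suc n)) κ h {y j′ k′} → reindexKind d κ h ≡ res y j′ k′ →
  ∃[ j ] ∃[ k ] (κ ≡ res y j k × punchIn d j′ ≡ j × punchIn d k′ ≡ k)
reindexKind-res⁻ d (res y j k) (d≢j , d≢k) refl =
  j , k , refl , Finₚ.punchIn-punchOut d≢j , Finₚ.punchIn-punchOut d≢k

reindexKind-leaf⁻ : ∀ {n} (d : Fin (suc n)) κ h → reindexKind d κ h ≡ leaf → κ ≡ leaf
reindexKind-leaf⁻ d leaf h _ = refl

reindexKind-leaf⁺ : ∀ {n} (d : Fin (suc n)) κ h → κ ≡ leaf → reindexKind d κ h ≡ leaf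
reindexKind-leaf⁺ d leaf h _ = refl

punchOut-< : ∀ {n} (d : Fin (suc n)) {j} (d≢j : d ≢ j) (t : Fin n) →
             toℕ j < toℕ (punchIn d t) → toℕ (punchOut d≢j) < toℕ t
punchOut-< fz     {fz}   d≢j t      j<t = ⊥-elim (d≢j refl)
punchOut-< fz     {fs j} d≢j t      j<t = ℕ.s<s⁻¹ j<t
punchOut-< (fs d) {fz}   d≢j (fs t) j<t = s≤s z≤n
punchOut-< (fs d) {fs j} d≢j (fs t) j<t = s≤s (punchOut-< d (d≢j ∘ cong fs) t (ℕ.s<s⁻¹ j<t))

module DeleteNode {S : ClauseSet} {n} (N : Fin (suc n) → Node (suc n)) (d : Fin (suc n))
                  (orphan : ∀ p → NotChildIn d (kind (N p))) where

  N⁻ : Fin n → Node n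
  N⁻ t = node (clause (N (punchIn d t))) (reindexKind d (kind (N (punchIn d t))) (orphan (punchIn d t)))

  ok⁻ : (∀ i → NodeOK S N i (kind (N i))) → ∀ t → NodeOK S N⁻ t (kind (N⁻ t))
  ok⁻ ok t = reindexOK (kind (N (punchIn d t))) (ok (punchIn d t)) (orphan (punchIn d t))
    where
    reindexOK : ∀ κ → NodeOK S N (punchIn d t) κ → (h : NotChildIn d κ) → NodeOK S N⁻ t (reindexKind d κ h)
    reindexOK leaf        o                 _           = o
    reindexOK (res y j k) (j<t , k<t , isRes) (d≢j , d≢k) =
      punchOut-< d d≢j t j<t , punchOut-< d d≢k t k<t ,
      subst₂ (λ C D → IsResolvent y C D (clause (N (punchIn d t))))
        (cong (clause ∘ N) (sym (Finₚ.punchIn-punchOut d≢j)))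
        (cong (clause ∘ N) (sym (Finₚ.punchIn-punchOut d≢k))) isRes

  walk⁻ : ∀ {t vs} → Walk N⁻ t vs → Walk N (punchIn d t) vs
  walk⁻ {t} (stop e) = stop (reindexKind-leaf⁻ d _ (orphan (punchIn d t)) e)
  walk⁻ {t} (left e w) with reindexKind-res⁻ d _ (orphan (punchIn d t)) e
  ... | _ , _ , e′ , refl , _ = left e′ (walk⁻ w)
  walk⁻ {t} (right e w) with reindexKind-res⁻ d _ (orphan (punchIn d t)) e
  ... | _ , _ , e′ , _ , refl = right e′ (walk⁻ w)

  stepsOnLeaves⁻ : ∀ {Q c₁ c₂} → StepsOnLeaves Q c₁ c₂ N → StepsOnLeaves Q c₁ c₂ N⁻
  stepsOnLeaves⁻ onLeaves t y j′ k′ qy e with reindexKind-res⁻ d _ (orphan (punchIn d t)) e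
  ... | _ , _ , e′ , refl , refl with onLeaves (punchIn d t) y _ _ qy e′
  ... | (j-leaf , cj) , (k-leaf , ck) =
    (reindexKind-leaf⁺ d _ (orphan (punchIn d j′)) j-leaf , cj) ,
    (reindexKind-leaf⁺ d _ (orphan (punchIn d k′)) k-leaf , ck)

  childClosed⁻ : (K : Vector Bool (suc n)) → ChildClosed N K → ChildClosed N⁻ (removeAt K d)
  childClosed⁻ K closed t y j′ k′ Kt e with reindexKind-res⁻ d _ (orphan (punchIn d t)) e
  ... | _ , _ , e′ , refl , refl = closed _ y _ _ Kt e′

Pruning : ∀ {S : ClauseSet} {n} → (Fin n → Node n) → Fin n → Vector Bool n → (Var → Set) → Clause → Clause → Set
Pruning {S} N r K Q c₁ c₂ = Σ[ P ∈ Proof S ] size P ≤ count K ×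
  (∀ vs → Walk (nodes P) (root P) vs → Walk N r vs) × StepsOnLeaves Q c₁ c₂ (nodes P)

-- Deleting parentless non-root nodes one at a time until none is left.
prune : ∀ {S : ClauseSet} n (N : Fin n → Node n) (ok : ∀ i → NodeOK S N i (kind (N i)))
  (r : Fin n) → clause (N r) ≡ [] → (K : Vector Bool n) → K r ≡ true → ChildClosed N K →
  ∀ {Q c₁ c₂} → StepsOnLeaves Q c₁ c₂ N → Pruning {S} N r K Q c₁ c₂
prune zero N ok () r-empty K Kr closed onLeaves
prune {S} (suc n) N ok r r-empty K Kr closed {Q} {c₁} {c₂} onLeaves
  with Finₚ.any? (λ d → ¬? (d Finₚ.≟ r) ×-dec Finₚ.all? (λ p → notChildIn? d (kind (N p))))
... | yes (d , d≢r , orphan) = lift (prune n D.N⁻ (D.ok⁻ ok) (punchOut d≢r) r⁻-empty (removeAt K d) Kr⁻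
                                            (D.childClosed⁻ K closed) (D.stepsOnLeaves⁻ onLeaves))
  where
  module D = DeleteNode {S} N d orphan
  r⁻-empty : clause (N (punchIn d (punchOut d≢r))) ≡ []
  r⁻-empty = trans (cong (clause ∘ N) (Finₚ.punchIn-punchOut d≢r)) r-empty
  Kr⁻ : K (punchIn d (punchOut d≢r)) ≡ true
  Kr⁻ = trans (cong K (Finₚ.punchIn-punchOut d≢r)) Kr
  lift : Pruning {S} D.N⁻ (punchOut d≢r) (removeAt K d) Q c₁ c₂ → Pruning {S} N r K Q c₁ c₂
  lift (P , size≤ , walks , onLeavesP) =
    P , ℕₚ.≤-trans size≤ (ℕₚ.≤-trans (ℕₚ.m≤n+m _ (bit (K d))) (ℕₚ.≤-reflexive (sym (count-removeAt K d)))) ,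
    (λ vs w → subst (λ z → Walk N z vs) (Finₚ.punchIn-punchOut d≢r) (D.walk⁻ (walks vs w))) , onLeavesP
... | no noOrphan = P , ℕₚ.≤-reflexive (sym (count-all K allKept)) , walks , onLeaves
  where
  parent : ∀ i → i ≢ r → HasParent N i
  parent i i≢r with Finₚ.all? (λ p → notChildIn? i (kind (N p)))
  ... | yes orphan = ⊥-elim (noOrphan (i , i≢r , orphan))
  ... | no notOrphan =
    let p , child = Finₚ.¬∀⟶∃¬ (suc n) _ (λ p → notChildIn? i (kind (N p))) notOrphan
    in ¬NotChildIn⇒HasParent N p child
  parent-above : ∀ i → (hp : HasParent N i) → toℕ i < toℕ (proj₁ hp)
  parent-above i (p , y , j , k , e , inj₁ refl) = proj₁ (NodeOK-res N ok e)
  parent-above i (p , y , j , k , e , inj₂ refl) = proj₁ (proj₂ (NodeOK-res N ok e))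
  r≡top : r ≡ fromℕ n
  r≡top with r Finₚ.≟ fromℕ n
  ... | yes r≡top = r≡top
  ... | no r≢top =
    let hp = parent (fromℕ n) (r≢top ∘ sym)
    in ⊥-elim (ℕₚ.<⇒≱ (parent-above (fromℕ n) hp)
                 (subst (toℕ (proj₁ hp) ≤_) (sym (Finₚ.toℕ-fromℕ n)) (Finₚ.toℕ≤pred[n] (proj₁ hp))))
  keptBelow : ∀ f t → n ∸ toℕ t < f → K t ≡ true
  keptBelow zero    t ()
  keptBelow (suc f) t t<f with t Finₚ.≟ r
  ... | yes refl = Kr
  ... | no t≢r with parent t t≢r
  ... | hp@(p , y , j , k , e , t≡child)
    with keptBelow f p (ℕₚ.<-≤-trans (ℕₚ.∸-monoʳ-< (parent-above t hp) (Finₚ.toℕ≤pred[n] p)) (ℕ.s≤s⁻¹ t<f))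
  ... | Kp with closed p y j k Kp e | t≡child
  ... | Kj , _ | inj₁ refl = Kj
  ... | _ , Kk | inj₂ refl = Kk
  allKept : ∀ t → K t ≡ true
  allKept t = keptBelow (suc (n ∸ toℕ t)) t (ℕₚ.n<1+n _)
  P : Proof S
  P = record { m = n ; nodes = N ; ok = ok ; root-empty = subst (λ z → clause (N z) ≡ []) r≡top r-empty
             ; connected = λ i i≢top → parent i (λ i≡r → i≢top (trans i≡r r≡top)) }
  walks : ∀ vs → Walk N (fromℕ n) vs → Walk N r vs
  walks vs w = subst (λ z → Walk N z vs) (sym r≡top) w

-- Every refutation of g x F γ resolves on x

_[_↦_] : Assignment → Var → Bool → Assignment
(α [ x ↦ b ]) v with v ℕ.≟ x
... | yes _ = b
... | no  _ = α v

[↦]-updates : ∀ α x b → (α [ x ↦ b ]) x ≡ b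
[↦]-updates α x b with x ℕ.≟ x
... | yes _   = refl
... | no x≢x = ⊥-elim (x≢x refl)

[↦]-minimal : ∀ α x b v → v ≢ x → (α [ x ↦ b ]) v ≡ α v
[↦]-minimal α x b v v≢x with v ℕ.≟ x
... | yes v≡x = ⊥-elim (v≢x v≡x)
... | no  _   = refl

ResolvesOn : ∀ {n} → (Fin n → Node n) → Var → Fin n → Set
ResolvesOn N x i = ∃[ j ] ∃[ k ] (kind (N i) ≡ res x j k)

resolvesOn? : ∀ {n} (N : Fin n → Node n) x i → Dec (ResolvesOn N x i)
resolvesOn? N x i with kind (N i)
... | leaf = no λ { (_ , _ , ()) }
... | res y j k with y ℕ.≟ x
...   | yes refl = yes (j , k , refl)
...   | no  y≢x  = no λ { (_ , _ , refl) → y≢x refl }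

module _ (F : CNF) (γ : Clause) (x : Var) (x∉F : NotIn x F) (sat : Satisfiable (F ∖ γ)) where

  private
    α = proj₁ sat
    α⊨F∖γ = proj₂ sat

    Invariant : Clause → Set
    Invariant C = pos x ∈ C ⊎ (α [ x ↦ false ]) ⊨ᶜ C

    leaf-invariant : ∀ C → g x F γ C → Invariant C
    leaf-invariant C (inj₁ (_ , x⊆C)) = inj₁ (x⊆C _ (here refl))
    leaf-invariant C (inj₂ (inj₁ (_ , ¬xγ⊆C))) = inj₂ (lose (¬xγ⊆C _ (here refl)) ([↦]-updates α x false))
    leaf-invariant C (inj₂ (inj₂ C∈F∖γ@(D , D∈F , _ , C⊆D , _))) =
      let l , l∈C , α⊨l = find (α⊨F∖γ C C∈F∖γ)
      in inj₂ (lose l∈C (trans ([↦]-minimal α x false (var l) (x∉F D D∈F l (C⊆D l l∈C))) α⊨l))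

    step-invariant : ∀ {y C D E} → y ≢ x → IsResolvent y C D E → Invariant C → Invariant D → Invariant E
    step-invariant y≢x (_ , _ , _ , complete) (inj₁ x∈C) _ =
      inj₁ (complete _ (inj₁ (x∈C , λ x≡y → y≢x (sym (cong var x≡y)))))
    step-invariant y≢x (_ , _ , _ , complete) (inj₂ _) (inj₁ x∈D) = inj₁ (complete _ (inj₂ (x∈D , λ ())))
    step-invariant y≢x isRes (inj₂ α⊨C) (inj₂ α⊨D) = inj₂ (resolvent-sound isRes α⊨C α⊨D)

  refutation-resolvesOn : ∀ {n} (N : Fin n → Node n) (ok : ∀ i → NodeOK (g x F γ) N i (kind (N i)))
                          (r : Fin n) → clause (N r) ≡ [] → ∃[ i ] ResolvesOn N x i
  refutation-resolvesOn {n} N ok r r-empty with Finₚ.any? (resolvesOn? N x)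
  ... | yes found = found
  ... | no none = ⊥-elim (root-invariant (<-rec (λ i → Invariant (clause (N i))) step r))
    where
    step : ∀ i → (∀ {c : Fin n} → c Fin.< i → Invariant (clause (N c))) → Invariant (clause (N i))
    step i ih with kind (N i) in eq | ok i
    ... | leaf      | isLeaf = leaf-invariant _ isLeaf
    ... | res y j k | j<i , k<i , isRes with y ℕ.≟ x
    ...   | yes refl = ⊥-elim (none (i , j , k , eq))
    ...   | no  y≢x  = step-invariant y≢x isRes (ih j<i) (ih k<i)
    root-invariant : Invariant (clause (N r)) → ⊥
    root-invariant rewrite r-empty = λ { (inj₁ ()) ; (inj₂ ()) }

Unique-resp-⊑ : ∀ {A : Set} {us vs : List A} → us ⊑ vs → Unique vs → Unique us
Unique-resp-⊑ []        []            = []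
Unique-resp-⊑ (_ ∷ʳ σ)  (_ ∷ !vs)     = Unique-resp-⊑ σ !vs
Unique-resp-⊑ (refl ∷ σ) (v∉vs ∷ !vs) = All.tabulate (All.lookup v∉vs ∘ Any-resp-⊆ σ) ∷ Unique-resp-⊑ σ !vs

module PushLast (x : Var) where

  -- the variables of a walk once its steps on x are replaced by one final step on x
  pushLast : List Var → List Var
  pushLast []       = x ∷ []
  pushLast (v ∷ vs) with v ℕ.≟ x
  ... | yes _ = pushLast vs
  ... | no  _ = v ∷ pushLast vs

  [x]⊑pushLast : ∀ vs → (x ∷ []) ⊑ pushLast vs
  [x]⊑pushLast []       = refl ∷ []
  [x]⊑pushLast (v ∷ vs) with v ℕ.≟ x
  ... | yes _ = [x]⊑pushLast vs
  ... | no  _ = v ∷ʳ [x]⊑pushLast vs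

  ⊑-pushLast-skip : ∀ {us} v vs → us ⊑ pushLast vs → us ⊑ pushLast (v ∷ vs)
  ⊑-pushLast-skip v vs σ with v ℕ.≟ x
  ... | yes _ = σ
  ... | no  _ = v ∷ʳ σ

  ⊑-pushLast-keep : ∀ {us} y vs → y ≢ x → us ⊑ pushLast vs → (y ∷ us) ⊑ pushLast (y ∷ vs)
  ⊑-pushLast-keep y vs y≢x σ with y ℕ.≟ x
  ... | yes y≡x = ⊥-elim (y≢x y≡x)
  ... | no  _   = refl ∷ σ

  ∈-pushLast⁻ : ∀ {u} vs → u ∈ pushLast vs → u ≡ x ⊎ u ∈ vs
  ∈-pushLast⁻ []       (here u≡x) = inj₁ u≡x
  ∈-pushLast⁻ (v ∷ vs) u∈ with v ℕ.≟ x | u∈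
  ... | yes _ | u∈′        = Sum.map₂ there (∈-pushLast⁻ vs u∈′)
  ... | no  _ | here u≡v   = inj₂ (here u≡v)
  ... | no  _ | there u∈′  = Sum.map₂ there (∈-pushLast⁻ vs u∈′)

  pushLast-unique : ∀ {vs} → Unique vs → Unique (pushLast vs)
  pushLast-unique {[]}     _            = [] ∷ []
  pushLast-unique {v ∷ vs} (v∉vs ∷ !vs) with v ℕ.≟ x
  ... | yes _   = pushLast-unique !vs
  ... | no  v≢x = All.tabulate v∉ ∷ pushLast-unique !vs
    where
    v∉ : ∀ {w} → w ∈ pushLast vs → v ≢ w
    v∉ w∈ with ∈-pushLast⁻ vs w∈
    ... | inj₁ refl = v≢x
    ... | inj₂ w∈vs = All.lookup v∉vs w∈vs

-- Restricting a refutation of g x F γ by x = 1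

module Restriction (F : CNF) (γ : Clause) (x : Var) (x∉F : NotIn x F) (γ∈F : γ ∈ F)
                   {n : ℕ} (N : Fin n → Node n) (ok : ∀ i → NodeOK (g x F γ) N i (kind (N i))) where

  open PushLast x

  S : ClauseSet
  S = g x F γ

  C : Fin n → Clause
  C i = clause (N i)

  NoX : Clause → Set
  NoX A = ∀ l → l ∈ A → var l ≢ x

  x∉γ : pos x ∉ γ
  x∉γ x∈γ = x∉F γ γ∈F (pos x) x∈γ refl

  -- Node i of N becomes node ↑ i of the restricted table, after the leaves x and ¬x ∨ γ.
  ↑ : Fin n → Fin (suc (suc n))
  ↑ i = fs (fs i)

  data Restricted : Set where
    satisfied  : Restricted
    subsumedBy : Fin n → Clause → Restricted

  record Outcome : Set where
    constructor outcome
    field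
      restricted : Restricted
      created    : Maybe (Kind (suc (suc n)) × Clause)
  open Outcome

  leafOutcome : ∀ i → S (C i) → Outcome
  leafOutcome i (inj₁ _)        = outcome satisfied nothing
  leafOutcome i (inj₂ (inj₁ _)) = outcome (subsumedBy i γ) (just (res x fz (fs fz) , γ))
  leafOutcome i (inj₂ (inj₂ _)) = outcome (subsumedBy i (C i)) (just (leaf , C i))

  resolveOutcome : Fin n → Var → Restricted → Restricted → Outcome
  resolveOutcome i y satisfied          _                  = outcome satisfied nothing
  resolveOutcome i y (subsumedBy _ _)   satisfied          = outcome satisfied nothing
  resolveOutcome i y (subsumedBy sj Aj) (subsumedBy sk Ak) with pos y ∈? Aj | neg y ∈? Ak
  ... | no _  | _     = outcome (subsumedBy sj Aj) nothing
  ... | yes _ | no _  = outcome (subsumedBy sk Ak) nothing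
  ... | yes _ | yes _ = outcome (subsumedBy i (resolvent y Aj Ak)) (just (res y (↑ sj) (↑ sk) , resolvent y Aj Ak))

  stepOutcome : ∀ i → Var → Restricted → Restricted → Outcome
  stepOutcome i y rj rk with y ℕ.≟ x
  ... | yes _ = outcome rk nothing
  ... | no  _ = resolveOutcome i y rj rk

  outcomeOf : ∀ i κ → NodeOK S N i κ → (∀ {c : Fin n} → c Fin.< i → Outcome) → Outcome
  outcomeOf i leaf        isLeaf          _  = leafOutcome i isLeaf
  outcomeOf i (res y j k) (j<i , k<i , _) rec = stepOutcome i y (restricted (rec {j} j<i)) (restricted (rec {k} k<i))

  outcomeAt : Fin n → Outcome
  outcomeAt = <-rec _ (λ i → outcomeOf i (kind (N i)) (ok i))

  restrictedAt : Fin n → Restricted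
  restrictedAt i = restricted (outcomeAt i)

  createdAt : Fin n → Maybe (Kind (suc (suc n)) × Clause)
  createdAt i = created (outcomeAt i)

  outcomeBelow : ∀ (i : Fin n) {c : Fin n} → c Fin.< i → Outcome
  outcomeBelow i {c} _ = outcomeAt c

  outcomeAt-unfold : ∀ i → outcomeAt i ≡ outcomeOf i (kind (N i)) (ok i) (λ {c} → outcomeBelow i {c})
  outcomeAt-unfold = <-rec-unfold _ (λ i → outcomeOf i (kind (N i)) (ok i)) outcomeOf-cong
    where
    outcomeOf-cong : ∀ i {h h′ : ∀ {c : Fin n} → c Fin.< i → Outcome} → (∀ {c : Fin n} (c<i : c Fin.< i) → h c<i ≡ h′ c<i) →
                     outcomeOf i (kind (N i)) (ok i) h ≡ outcomeOf i (kind (N i)) (ok i) h′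
    outcomeOf-cong i h≗h′ with kind (N i) | ok i
    ... | leaf      | _             = refl
    ... | res y j k | j<i , k<i , _ =
      cong₂ (λ oj ok′ → stepOutcome i y (restricted oj) (restricted ok′)) (h≗h′ j<i) (h≗h′ k<i)

  data View (i : Fin n) : Outcome → Set where
    unitClause    : kind (N i) ≡ leaf → C i ≐ (pos x ∷ []) → View i (outcome satisfied nothing)
    xClause       : kind (N i) ≡ leaf → C i ≐ (neg x ∷ γ) →
                    View i (outcome (subsumedBy i γ) (just (res x fz (fs fz) , γ)))
    inputClause   : kind (N i) ≡ leaf → (F ∖ γ) (C i) →
                    View i (outcome (subsumedBy i (C i)) (just (leaf , C i)))
    onX-satisfied : ∀ {j k} → kind (N i) ≡ res x j k → restrictedAt k ≡ satisfied →
                    View i (outcome satisfied nothing)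
    onX-forward   : ∀ {j k s A} → kind (N i) ≡ res x j k → restrictedAt k ≡ subsumedBy s A →
                    View i (outcome (subsumedBy s A) nothing)
    satisfiedˡ    : ∀ {y j k} → kind (N i) ≡ res y j k → y ≢ x → restrictedAt j ≡ satisfied →
                    View i (outcome satisfied nothing)
    satisfiedʳ    : ∀ {y j k} → kind (N i) ≡ res y j k → y ≢ x → restrictedAt k ≡ satisfied →
                    View i (outcome satisfied nothing)
    forwardˡ      : ∀ {y j k sj Aj sk Ak} → kind (N i) ≡ res y j k → y ≢ x →
                    restrictedAt j ≡ subsumedBy sj Aj → restrictedAt k ≡ subsumedBy sk Ak → pos y ∉ Aj →
                    View i (outcome (subsumedBy sj Aj) nothing)
    forwardʳ      : ∀ {y j k sj Aj sk Ak} → kind (N i) ≡ res y j k → y ≢ x →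
                    restrictedAt j ≡ subsumedBy sj Aj → restrictedAt k ≡ subsumedBy sk Ak → neg y ∉ Ak →
                    View i (outcome (subsumedBy sk Ak) nothing)
    resolved      : ∀ {y j k sj Aj sk Ak} → kind (N i) ≡ res y j k → y ≢ x →
                    restrictedAt j ≡ subsumedBy sj Aj → restrictedAt k ≡ subsumedBy sk Ak → pos y ∈ Aj → neg y ∈ Ak →
                    View i (outcome (subsumedBy i (resolvent y Aj Ak)) (just (res y (↑ sj) (↑ sk) , resolvent y Aj Ak)))

  viewStep : ∀ {i y j k} → kind (N i) ≡ res y j k → View i (stepOutcome i y (restrictedAt j) (restrictedAt k))
  viewStep {i} {y} {j} {k} e with y ℕ.≟ x
  ... | yes refl with restrictedAt k in rk
  ...   | satisfied      = onX-satisfied e rk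
  ...   | subsumedBy s A = onX-forward e rk
  viewStep {i} {y} {j} {k} e | no y≢x with restrictedAt j in rj | restrictedAt k in rk
  ... | satisfied        | _                = satisfiedˡ e y≢x rj
  ... | subsumedBy _ _   | satisfied        = satisfiedʳ e y≢x rk
  ... | subsumedBy sj Aj | subsumedBy sk Ak with pos y ∈? Aj | neg y ∈? Ak
  ...   | no py∉   | _       = forwardˡ e y≢x rj rk py∉
  ...   | yes _   | no ny∉  = forwardʳ e y≢x rj rk ny∉
  ...   | yes py∈ | yes ny∈ = resolved e y≢x rj rk py∈ ny∈

  view : ∀ i → View i (outcomeAt i)
  view i = subst (View i) (sym (outcomeAt-unfold i)) (viewOf (kind (N i)) refl (ok i))
    where
    viewOf : ∀ κ → kind (N i) ≡ κ → (o : NodeOK S N i κ) → View i (outcomeOf i κ o (λ {c} → outcomeBelow i {c}))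
    viewOf leaf        e (inj₁ isUnit)         = unitClause e isUnit
    viewOf leaf        e (inj₂ (inj₁ isXγ))    = xClause e isXγ
    viewOf leaf        e (inj₂ (inj₂ isInput)) = inputClause e isInput
    viewOf (res y j k) e _                     = viewStep e

  Faithful : Fin n → Restricted → Set
  Faithful i satisfied        = pos x ∈ C i
  Faithful i (subsumedBy s A) = A ⊆ᶜ C i × NoX A × pos x ∉ C i × toℕ s ≤ toℕ i × ∃[ κ ] createdAt s ≡ just (κ , A)

  faithful : ∀ i → Faithful i (restrictedAt i)
  faithful = <-rec _ λ i ih → faithfulStep i ih refl (view i)
    where
    faithfulStep : ∀ i → (∀ {c : Fin n} → c Fin.< i → Faithful c (restrictedAt c)) →
                   ∀ {o} → outcomeAt i ≡ o → View i o → Faithful i (restricted o)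
    faithfulStep i ih o≡ (unitClause _ (_ , x⊆C)) = x⊆C _ (here refl)
    faithfulStep i ih o≡ (xClause _ (C⊆ , ⊆C)) =
      (λ l → ⊆C l ∘ there) , x∉F γ γ∈F , x∉C , ℕₚ.≤-refl , _ , cong created o≡
      where
      x∉C : pos x ∉ C i
      x∉C x∈C with C⊆ _ x∈C
      ... | there x∈γ = x∉γ x∈γ
    faithfulStep i ih o≡ (inputClause _ (D , D∈F , _ , C⊆D , _)) =
      (λ _ l∈ → l∈) , (λ l → x∉F D D∈F l ∘ C⊆D l) , (λ x∈C → x∉F D D∈F _ (C⊆D _ x∈C) refl) ,
      ℕₚ.≤-refl , _ , cong created o≡
    faithfulStep i ih o≡ (onX-satisfied e k-sat) =
      let _ , k<i , (_ , _ , _ , complete) = NodeOK-res N ok e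
      in complete _ (inj₂ (subst (Faithful _) k-sat (ih k<i) , λ ()))
    faithfulStep i ih o≡ (onX-forward e k-sub) with NodeOK-res N ok e
    ... | j<i , k<i , isRes@(x∈Cj , _) with subst (Faithful _) k-sub (ih k<i)
    ... | A⊆Ck , noX , x∉Ck , s≤k , created =
      ⊆-resolventʳ isRes A⊆Ck (λ ¬x∈A → noX _ ¬x∈A refl) , noX ,
      x∉E , ℕₚ.≤-trans s≤k (ℕₚ.<⇒≤ k<i) , created
      where
      x∉E : pos x ∉ C i
      x∉E x∈Ci with proj₁ (proj₂ (proj₂ isRes)) _ x∈Ci
      ... | inj₁ (_ , x≢x) = x≢x refl
      ... | inj₂ (x∈Ck , _) = x∉Ck x∈Ck
    faithfulStep i ih o≡ (satisfiedˡ e y≢x j-sat) =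
      let j<i , _ , (_ , _ , _ , complete) = NodeOK-res N ok e
      in complete _ (inj₁ (subst (Faithful _) j-sat (ih j<i) , λ x≡y → y≢x (sym (cong var x≡y))))
    faithfulStep i ih o≡ (satisfiedʳ e y≢x k-sat) =
      let _ , k<i , (_ , _ , _ , complete) = NodeOK-res N ok e
      in complete _ (inj₂ (subst (Faithful _) k-sat (ih k<i) , λ ()))
    faithfulStep i ih o≡ (forwardˡ e y≢x j-sub k-sub py∉) with NodeOK-res N ok e
    ... | j<i , k<i , isRes with subst (Faithful _) j-sub (ih j<i) | subst (Faithful _) k-sub (ih k<i)
    ... | A⊆Cj , noX , x∉Cj , s≤j , created | _ , _ , x∉Ck , _ =
      ⊆-resolventˡ isRes A⊆Cj py∉ , noX , ∉-resolvent isRes x∉Cj x∉Ck , ℕₚ.≤-trans s≤j (ℕₚ.<⇒≤ j<i) , created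
    faithfulStep i ih o≡ (forwardʳ e y≢x j-sub k-sub ny∉) with NodeOK-res N ok e
    ... | j<i , k<i , isRes with subst (Faithful _) j-sub (ih j<i) | subst (Faithful _) k-sub (ih k<i)
    ... | _ , _ , x∉Cj , _ | A⊆Ck , noX , x∉Ck , s≤k , created =
      ⊆-resolventʳ isRes A⊆Ck ny∉ , noX , ∉-resolvent isRes x∉Cj x∉Ck , ℕₚ.≤-trans s≤k (ℕₚ.<⇒≤ k<i) , created
    faithfulStep i ih o≡ (resolved {y} {Aj = Aj} {Ak = Ak} e y≢x j-sub k-sub _ _) with NodeOK-res N ok e
    ... | j<i , k<i , isRes with subst (Faithful _) j-sub (ih j<i) | subst (Faithful _) k-sub (ih k<i)
    ... | Aj⊆Cj , noXj , x∉Cj , _ | Ak⊆Ck , noXk , x∉Ck , _ =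
      resolvent-⊆ isRes Aj⊆Cj Ak⊆Ck , noX , ∉-resolvent isRes x∉Cj x∉Ck , ℕₚ.≤-refl , _ , cong created o≡
      where
      noX : NoX (resolvent y Aj Ak)
      noX l l∈ = [ noXj l , noXk l ]′ (∈-++⁻ Aj (resolvent-⊆ᶜ-++ y Aj Ak l l∈))

  fromCreated : Maybe (Kind (suc (suc n)) × Clause) → Node (suc (suc n))
  fromCreated nothing         = node (pos x ∷ []) leaf
  fromCreated (just (κ , A)) = node A κ

  restrictedNodes : Fin (suc (suc n)) → Node (suc (suc n))
  restrictedNodes fz          = node (pos x ∷ []) leaf
  restrictedNodes (fs fz)     = node (neg x ∷ γ) leaf
  restrictedNodes (fs (fs i)) = fromCreated (createdAt i)

  kept : Vector Bool (suc (suc n))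
  kept fz          = true
  kept (fs fz)     = true
  kept (fs (fs i)) = is-just (createdAt i)

  created⇒clause : ∀ {s κ A} → createdAt s ≡ just (κ , A) → clause (restrictedNodes (↑ s)) ≡ A
  created⇒clause = cong (clause ∘ fromCreated)

  created⇒kind : ∀ {s κ A} → createdAt s ≡ just (κ , A) → kind (restrictedNodes (↑ s)) ≡ κ
  created⇒kind = cong (kind ∘ fromCreated)

  created⇒kept : ∀ {s p} → createdAt s ≡ just p → kept (↑ s) ≡ true
  created⇒kept = cong is-just

  x-resolves-leaves : IsResolvent x (pos x ∷ []) (neg x ∷ γ) γ
  x-resolves-leaves = here refl , here refl , sound , complete
    where
    sound : ∀ l → l ∈ γ → _
    sound l l∈γ = inj₂ (there l∈γ , λ l≡¬x → x∉F γ γ∈F l l∈γ (cong var l≡¬x))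
    complete : ∀ l → _ → l ∈ γ
    complete l (inj₁ (here refl , l≢x)) = ⊥-elim (l≢x refl)
    complete l (inj₂ (here refl , l≢¬x)) = ⊥-elim (l≢¬x refl)
    complete l (inj₂ (there l∈γ , _)) = l∈γ

  -- NodeOK for a given clause: the clause of restrictedNodes (↑ i) is only known once createdAt i is.
  ValidAt : Fin (suc (suc n)) → Kind (suc (suc n)) → Clause → Set
  ValidAt t leaf        A = S A
  ValidAt t (res y a b) A =
    toℕ a < toℕ t × toℕ b < toℕ t × IsResolvent y (clause (restrictedNodes a)) (clause (restrictedNodes b)) A

  created-valid : ∀ i {o κ A} → View i o → created o ≡ just (κ , A) → ValidAt (↑ i) κ A
  created-valid i (xClause _ _)        refl = s≤s z≤n , s≤s (s≤s z≤n) , x-resolves-leaves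
  created-valid i (inputClause _ isIn) refl = inj₂ (inj₂ isIn)
  created-valid i (resolved {y} e y≢x j-sub k-sub py∈ ny∈) refl with NodeOK-res N ok e
  ... | j<i , k<i , _ with subst (Faithful _) j-sub (faithful _) | subst (Faithful _) k-sub (faithful _)
  ... | _ , _ , _ , sj≤j , _ , cj | _ , _ , _ , sk≤k , _ , ck =
    s≤s (s≤s (ℕₚ.≤-<-trans sj≤j j<i)) , s≤s (s≤s (ℕₚ.≤-<-trans sk≤k k<i)) ,
    subst₂ (λ Aj Ak → IsResolvent y Aj Ak _) (sym (created⇒clause cj)) (sym (created⇒clause ck))
      (resolvent-isResolvent py∈ ny∈)

  ValidAt⇒NodeOK : ∀ t κ → ValidAt t κ (clause (restrictedNodes t)) → NodeOK S restrictedNodes t κ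
  ValidAt⇒NodeOK t leaf        valid = valid
  ValidAt⇒NodeOK t (res y a b) valid = valid

  restrictedNodes-ok : ∀ t → NodeOK S restrictedNodes t (kind (restrictedNodes t))
  restrictedNodes-ok fz          = inj₁ ≐-refl
  restrictedNodes-ok (fs fz)     = inj₂ (inj₁ ≐-refl)
  restrictedNodes-ok (fs (fs i)) = ValidAt⇒NodeOK (↑ i) _ (valid (createdAt i) refl)
    where
    valid : ∀ m → createdAt i ≡ m → ValidAt (↑ i) (kind (fromCreated m)) (clause (fromCreated m))
    valid nothing        _  = inj₁ ≐-refl
    valid (just (κ , A)) eq = created-valid i (view i) eq

  restrictedNodes-closed : ChildClosed restrictedNodes kept
  restrictedNodes-closed fz          _ _ _ _ ()
  restrictedNodes-closed (fs fz)     _ _ _ _ ()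
  restrictedNodes-closed (fs (fs i)) y a b _ e = closedAt (createdAt i) refl e
    where
    closedFor : ∀ {o κ A} → View i o → created o ≡ just (κ , A) → κ ≡ res y a b → kept a ≡ true × kept b ≡ true
    closedFor (xClause _ _)    refl refl = refl , refl
    closedFor (inputClause _ _) refl ()
    closedFor (resolved _ _ j-sub k-sub _ _) refl refl =
      let _ , _ , _ , _ , _ , cj = subst (Faithful _) j-sub (faithful _)
          _ , _ , _ , _ , _ , ck = subst (Faithful _) k-sub (faithful _)
      in created⇒kept cj , created⇒kept ck
    closedAt : ∀ m → createdAt i ≡ m → kind (fromCreated m) ≡ res y a b → kept a ≡ true × kept b ≡ true
    closedAt (just (κ , A)) eq e = closedFor (view i) eq e

  restrictedNodes-onLeaves : StepsOnLeaves (_≡ x) (pos x ∷ []) (neg x ∷ γ) restrictedNodes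
  restrictedNodes-onLeaves fz          _ _ _ _    ()
  restrictedNodes-onLeaves (fs fz)     _ _ _ _    ()
  restrictedNodes-onLeaves (fs (fs i)) y a b refl e = onLeavesAt (createdAt i) refl e
    where
    Conclusion = (kind (restrictedNodes a) ≡ leaf × clause (restrictedNodes a) ≐ (pos x ∷ [])) ×
                 (kind (restrictedNodes b) ≡ leaf × clause (restrictedNodes b) ≐ (neg x ∷ γ))
    onLeavesFor : ∀ {o κ A} → View i o → created o ≡ just (κ , A) → κ ≡ res x a b → Conclusion
    onLeavesFor (xClause _ _)     refl refl = (refl , ≐-refl) , (refl , ≐-refl)
    onLeavesFor (inputClause _ _) refl ()
    onLeavesFor (resolved _ y≢x _ _ _ _) refl refl = ⊥-elim (y≢x refl)
    onLeavesAt : ∀ m → createdAt i ≡ m → kind (fromCreated m) ≡ res x a b → Conclusion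
    onLeavesAt (just (κ , A)) eq e = onLeavesFor (view i) eq e

  WalkBack : Fin n → Set
  WalkBack i = ∀ {s A} → restrictedAt i ≡ subsumedBy s A →
               ∀ {us} → Walk restrictedNodes (↑ s) us → ∃[ vs ] (Walk N i vs × us ⊑ pushLast vs)

  walkBack : ∀ i → WalkBack i
  walkBack = <-rec _ λ i ih → walkBackStep i ih refl (view i)
    where
    walkBackStep : ∀ i → (∀ {c : Fin n} → c Fin.< i → WalkBack c) → ∀ {o} → outcomeAt i ≡ o → View i o →
                   ∀ {s A} → restricted o ≡ subsumedBy s A →
                   ∀ {us} → Walk restrictedNodes (↑ s) us → ∃[ vs ] (Walk N i vs × us ⊑ pushLast vs)
    walkBackStep i ih o≡ (xClause isLeaf _) refl w with created⇒kind (cong created o≡) | w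
    ... | kind≡ | stop e′ with () ← trans (sym kind≡) e′
    ... | kind≡ | left e′ w′ with refl ← trans (sym kind≡) e′ rewrite Walk-leaf refl w′ = [] , stop isLeaf , refl ∷ []
    ... | kind≡ | right e′ w′ with refl ← trans (sym kind≡) e′ rewrite Walk-leaf refl w′ = [] , stop isLeaf , refl ∷ []
    walkBackStep i ih o≡ (inputClause isLeaf _) refl w with created⇒kind (cong created o≡) | w
    ... | kind≡ | stop _     = [] , stop isLeaf , minimum _
    ... | kind≡ | left e′ _  with () ← trans (sym kind≡) e′
    ... | kind≡ | right e′ _ with () ← trans (sym kind≡) e′
    walkBackStep i ih o≡ (onX-forward e k-sub) refl w =
      let vs , wk , σ = ih (proj₁ (proj₂ (NodeOK-res N ok e))) k-sub w
      in x ∷ vs , right e wk , ⊑-pushLast-skip x vs σ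
    walkBackStep i ih o≡ (forwardˡ {y} e _ j-sub _ _) refl w =
      let vs , wj , σ = ih (proj₁ (NodeOK-res N ok e)) j-sub w
      in y ∷ vs , left e wj , ⊑-pushLast-skip y vs σ
    walkBackStep i ih o≡ (forwardʳ {y} e _ _ k-sub _) refl w =
      let vs , wk , σ = ih (proj₁ (proj₂ (NodeOK-res N ok e))) k-sub w
      in y ∷ vs , right e wk , ⊑-pushLast-skip y vs σ
    walkBackStep i ih o≡ (resolved {y} e y≢x j-sub k-sub _ _) refl w with created⇒kind (cong created o≡) | w
    ... | kind≡ | stop e′ with () ← trans (sym kind≡) e′
    ... | kind≡ | left e′ w′ with refl ← trans (sym kind≡) e′ =
      let vs , wj , σ = ih (proj₁ (NodeOK-res N ok e)) j-sub w′
      in y ∷ vs , left e wj , ⊑-pushLast-keep y vs y≢x σ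
    ... | kind≡ | right e′ w′ with refl ← trans (sym kind≡) e′ =
      let vs , wk , σ = ih (proj₁ (proj₂ (NodeOK-res N ok e))) k-sub w′
      in y ∷ vs , right e wk , ⊑-pushLast-keep y vs y≢x σ

  creates : Vector Bool n
  creates i = is-just (createdAt i)

  created⇒subsumed : ∀ i {o p} → View i o → created o ≡ just p → ∃[ A ] restricted o ≡ subsumedBy i A
  created⇒subsumed i (xClause _ _)            refl = γ , refl
  created⇒subsumed i (inputClause _ _)        refl = C i , refl
  created⇒subsumed i (resolved _ _ _ _ _ _) refl = _ , refl

  x∈⇒not-kept : ∀ i → pos x ∈ C i → creates i ≡ false
  x∈⇒not-kept i x∈C = notKept (createdAt i) refl
    where
    notKept : ∀ m → createdAt i ≡ m → is-just m ≡ false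
    notKept nothing  _  = refl
    notKept (just p) eq with created⇒subsumed i (view i) eq
    ... | A , sub = ⊥-elim (proj₁ (proj₂ (proj₂ (subst (Faithful i) sub (faithful i)))) x∈C)

  x-step-not-kept : ∀ {i j k} → kind (N i) ≡ res x j k → creates i ≡ false
  x-step-not-kept {i} e = cong is-just (notCreated (view i))
    where
    notCreated : ∀ {o} → View i o → created o ≡ nothing
    notCreated (unitClause _ _)              = refl
    notCreated (xClause isLeaf _)            with () ← trans (sym isLeaf) e
    notCreated (inputClause isLeaf _)        with () ← trans (sym isLeaf) e
    notCreated (onX-satisfied _ _)           = refl
    notCreated (onX-forward _ _)             = refl
    notCreated (satisfiedˡ _ _ _)            = refl
    notCreated (satisfiedʳ _ _ _)            = refl
    notCreated (forwardˡ _ _ _ _ _)          = refl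
    notCreated (forwardʳ _ _ _ _ _)          = refl
    notCreated (resolved e′ y≢x _ _ _ _)     with refl ← trans (sym e) e′ = ⊥-elim (y≢x refl)

  x-child-not-kept : ∀ {i j k} → kind (N i) ≡ res x j k → creates j ≡ false
  x-child-not-kept e = let _ , _ , x∈Cj , _ = NodeOK-res N ok e in x∈⇒not-kept _ x∈Cj

  x-step⇒2+count≤n : ∀ {i j k} → kind (N i) ≡ res x j k → 2 + count creates ≤ n
  x-step⇒2+count≤n {i} {j} e =
    unmarked+count≤n creates (i ∷ j ∷ []) ((i≢j ∷ []) ∷ [] ∷ [])
      (x-step-not-kept e ∷ x-child-not-kept e ∷ [])
    where i≢j = ≢-sym (Finₚ.<⇒≢ (proj₁ (NodeOK-res N ok e)))

  two-x-steps⇒3+count≤n : ∀ {i j k i′ j′ k′} → kind (N i) ≡ res x j k → kind (N i′) ≡ res x j′ k′ → i′ ≢ i →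
                 3 + count creates ≤ n
  two-x-steps⇒3+count≤n {i} {j} {_} {i′} {j′} e e′ i′≢i with j Finₚ.≟ i′
  ... | no j≢i′ =
    unmarked+count≤n creates (i′ ∷ i ∷ j ∷ []) ((i′≢i ∷ ≢-sym j≢i′ ∷ []) ∷ (i≢j ∷ []) ∷ [] ∷ [])
      (x-step-not-kept e′ ∷ x-step-not-kept e ∷ x-child-not-kept e ∷ [])
    where i≢j = ≢-sym (Finₚ.<⇒≢ (proj₁ (NodeOK-res N ok e)))
  ... | yes refl =
    unmarked+count≤n creates (i′ ∷ i ∷ j′ ∷ []) ((i′≢i ∷ i′≢j′ ∷ []) ∷ (i≢j′ ∷ []) ∷ [] ∷ [])
      (x-step-not-kept e′ ∷ x-step-not-kept e ∷ x-child-not-kept e′ ∷ [])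
    where
    j′<i′ = proj₁ (NodeOK-res N ok e′)
    i′≢j′ = ≢-sym (Finₚ.<⇒≢ j′<i′)
    i≢j′  = ≢-sym (Finₚ.<⇒≢ (ℕₚ.<-trans j′<i′ (proj₁ (NodeOK-res N ok e))))

  restrict : (r : Fin n) → C r ≡ [] → (∀ vs → Walk N r vs → Unique vs) →
             Σ[ Q ∈ Proof S ] Regular Q × size Q ≤ 2 + count creates ×
                              StepsOnLeaves (_≡ x) (pos x ∷ []) (neg x ∷ γ) (nodes Q)
  restrict r r-empty unique = restrictFrom (restrictedAt r) refl (faithful r)
    where
    restrictFrom : ∀ ρ → restrictedAt r ≡ ρ → Faithful r ρ →
                   Σ[ Q ∈ Proof S ] Regular Q × size Q ≤ 2 + count creates ×
                                    StepsOnLeaves (_≡ x) (pos x ∷ []) (neg x ∷ γ) (nodes Q)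
    restrictFrom satisfied        _  x∈Cr with () ← subst (pos x ∈_) r-empty x∈Cr
    restrictFrom (subsumedBy s A) eq (A⊆Cr , _ , _ , _ , _ , created)
      with prune (suc (suc n)) restrictedNodes restrictedNodes-ok (↑ s) root-empty′ kept (created⇒kept created)
                 restrictedNodes-closed restrictedNodes-onLeaves
      where
      root-empty′ : clause (restrictedNodes (↑ s)) ≡ []
      root-empty′ = trans (created⇒clause created) (⊆ᶜ[]⇒≡[] A (subst (A ⊆ᶜ_) r-empty A⊆Cr))
    ... | Q , size≤ , walks , onLeaves = Q , regular , size≤ , onLeaves
      where
      regular : Regular Q
      regular vs w =
        let vs₀ , w₀ , σ = walkBack r eq (walks vs (Path⇒Walk Q w))
        in Unique-resp-⊑ σ (pushLast-unique (unique vs₀ w₀))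

module _ (F : CNF) (γ : Clause) (x : Var) (γ∈F : γ ∈ F) (sat : Satisfiable (F ∖ γ)) (x∉F : NotIn x F) where

  private
    S = g x F γ

  proof-resolvesOn : (P : Proof S) → ∃[ i ] ResOn P x i
  proof-resolvesOn P = refutation-resolvesOn F γ x x∉F sat (nodes P) (ok P) (root P) (root-empty P)

  regular⇒walksUnique : (P : Proof S) → Regular P → ∀ vs → Walk (nodes P) (root P) vs → Unique vs
  regular⇒walksUnique P regular vs w = regular vs (Walk⇒Path P w)

  restriction : (P : Proof S) → Regular P →
    Σ[ Q ∈ Proof S ] (Regular Q × StepsOnLeaves (_≡ x) (pos x ∷ []) (neg x ∷ γ) (nodes Q) × size Q ≤ size P ×
                      (∀ i i′ → ResOn P x i → ResOn P x i′ → i′ ≢ i → size Q < size P))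
  restriction P regular =
    let _ , _ , _ , e = proof-resolvesOn P
        Q , regularQ , size≤ , onLeaves = restrict (root P) (root-empty P) (regular⇒walksUnique P regular)
    in Q , regularQ , onLeaves , ℕₚ.≤-trans size≤ (x-step⇒2+count≤n e) ,
       λ { i i′ (_ , _ , e₁) (_ , _ , e₂) i′≢i → ℕₚ.<-≤-trans (s≤s size≤) (two-x-steps⇒3+count≤n e₁ e₂ i′≢i) }
    where open Restriction F γ x x∉F γ∈F (nodes P) (ok P)

  optimal⇒exactlyOneResOn : (P : Proof S) → OptimalRegular P → ExactlyOneResOn P x
  optimal⇒exactlyOneResOn P (regular , optimal) =
    let i , step = proof-resolvesOn P
        Q , regularQ , _ , _ , smaller = restriction P regular
    in i , step , λ i′ step′ →
         decidable-stable (i′ Finₚ.≟ i) λ i′≢i → ℕₚ.<⇒≱ (smaller i i′ step step′ i′≢i) (optimal Q regularQ)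

  optimal⇒optimalWithLeafStep : (P : Proof S) → OptimalRegular P →
    Σ[ Q ∈ Proof S ] (OptimalRegular Q × ExactlyOneResOn Q x ×
      (∃[ i ] ∃[ j ] ∃[ k ] (kind (nodes Q i) ≡ res x j k × IsLeaf Q j × IsLeaf Q k ×
         clause (nodes Q j) ≐ (pos x ∷ []) × clause (nodes Q k) ≐ (neg x ∷ γ))))
  optimal⇒optimalWithLeafStep P (regular , optimal) =
    let Q , regularQ , onLeaves , size≤ , _ = restriction P regular
        optimalQ = regularQ , λ Q′ regularQ′ → ℕₚ.≤-trans size≤ (optimal Q′ regularQ′)
        i , j , k , e = proof-resolvesOn Q
        (j-leaf , cj) , (k-leaf , ck) = onLeaves i x j k refl e
    in Q , optimalQ , optimal⇒exactlyOneResOn Q optimalQ , i , j , k , e , j-leaf , k-leaf , cj , ck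

-- Finite search

∀∈? : ∀ {A : Set} {P : A → Set} → (∀ a → Dec (P a)) → (as : List A) → Dec (∀ a → a ∈ as → P a)
∀∈? P? as = map′ (λ all a → All.lookup all) (λ h → All.tabulate (h _)) (All.all? P? as)

∃∈? : ∀ {A : Set} {P : A → Set} → (∀ a → Dec (P a)) → (as : List A) → Dec (∃[ a ] (a ∈ as × P a))
∃∈? P? as = map′ find (λ (_ , a∈ , pa) → lose a∈ pa) (Any.any? P? as)

∃-vector? : ∀ {A : Set} (As : List A) k (P : Vector A k → Set) → (∀ f → Dec (P f)) →
            (∀ {f f′} → (∀ t → f t ≡ f′ t) → P f → P f′) →
            Dec (Σ[ f ∈ Vector A k ] ((∀ t → f t ∈ As) × P f))
∃-vector? As zero P P? P-resp with P? (λ ())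
... | yes p  = yes ((λ ()) , (λ ()) , p)
... | no ¬p  = no λ (f , _ , pf) → ¬p (P-resp (λ ()) pf)
∃-vector? As (suc k) P P? P-resp
  with ∃∈? (λ a → ∃-vector? As k (P ∘ (a ◃_)) (P? ∘ (a ◃_)) (λ f≗f′ → P-resp λ { fz → refl ; (fs t) → f≗f′ t })) As
... | yes (a , a∈ , f , f∈ , pf) = yes ((a ◃ f) , (λ { fz → a∈ ; (fs t) → f∈ t }) , pf)
... | no none = no λ (f , f∈ , pf) →
  none (head f , f∈ fz , tail f , f∈ ∘ fs , P-resp (λ { fz → refl ; (fs t) → refl }) pf)

least : (P : ℕ → Set) → (∀ k → Dec (P k)) → ∀ n → P n → ∃[ k ] (P k × (∀ k′ → P k′ → k ≤ k′))
least P P? zero    p = 0 , p , λ _ _ → z≤n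
least P P? (suc n) p with P? 0
... | yes p₀ = 0 , p₀ , λ _ _ → z≤n
... | no ¬p₀ with least (P ∘ suc) (P? ∘ suc) n p
... | k , pk , min = suc k , pk , λ { zero p₀ → ⊥-elim (¬p₀ p₀) ; (suc k′) pk′ → s≤s (min k′ pk′) }

_≐?_ : (C D : Clause) → Dec (C ≐ D)
C ≐? D = ∀∈? (_∈? D) C ×-dec ∀∈? (_∈? C) D

IsResolvent-resp-≐ : ∀ {y C D E C′ D′ E′} → IsResolvent y C D E → C ≐ C′ → D ≐ D′ → E ≐ E′ →
                     IsResolvent y C′ D′ E′
IsResolvent-resp-≐ (py∈C , ny∈D , sound , complete) (C⊆ , ⊆C) (D⊆ , ⊆D) (E⊆ , ⊆E) =
  C⊆ _ py∈C , D⊆ _ ny∈D ,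
  (λ l → Sum.map (map₁ (C⊆ l)) (map₁ (D⊆ l)) ∘ sound l ∘ ⊆E l) ,
  (λ l → E⊆ l ∘ complete l ∘ Sum.map (map₁ (⊆C l)) (map₁ (⊆D l)))

isResolvent? : ∀ y C D E → Dec (IsResolvent y C D E)
isResolvent? y C D E = (pos y ∈? C) ×-dec ((neg y ∈? D) ×-dec (sound? ×-dec complete?))
  where
  sound? = ∀∈? (λ l → ((l ∈? C) ×-dec ¬? (l ≟ˡ pos y)) ⊎-dec ((l ∈? D) ×-dec ¬? (l ≟ˡ neg y))) E
  kept? : ∀ a l → Dec (l ≢ a → l ∈ E)
  kept? a l with l ≟ˡ a | l ∈? E
  ... | yes l≡a | _       = yes λ l≢a → ⊥-elim (l≢a l≡a)
  ... | no _    | yes l∈E = yes λ _ → l∈E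
  ... | no l≢a  | no l∉E  = no λ kept → l∉E (kept l≢a)
  complete? : Dec (∀ l → (l ∈ C × l ≢ pos y) ⊎ (l ∈ D × l ≢ neg y) → l ∈ E)
  complete? = map′ (λ (fromC , fromD) l → [ uncurry (fromC l) , uncurry (fromD l) ]′)
                   (λ complete → (λ l l∈ l≢ → complete l (inj₁ (l∈ , l≢))) , (λ l l∈ l≢ → complete l (inj₂ (l∈ , l≢))))
                   (∀∈? (kept? (pos y)) C ×-dec ∀∈? (kept? (neg y)) D)

unique? : (vs : List Var) → Dec (Unique vs)
unique? = AllPairs.allPairs? (λ u v → ¬? (u ℕ.≟ v))

sublists : List Lit → List Clause
sublists []       = [] ∷ []
sublists (l ∷ ls) = map (l ∷_) (sublists ls) ++ sublists ls

filter-∈-sublists : ∀ {P : Lit → Set} (P? : ∀ l → Dec (P l)) ls → filter P? ls ∈ sublists ls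
filter-∈-sublists P? []       = here refl
filter-∈-sublists P? (l ∷ ls) with does (P? l)
... | true  = ∈-++⁺ˡ (∈-map⁺ (l ∷_) (filter-∈-sublists P? ls))
... | false = ∈-++⁺ʳ (map (l ∷_) (sublists ls)) (filter-∈-sublists P? ls)

module Search (S : ClauseSet) (S? : ∀ C → Dec (S C)) (S-resp-≐ : ∀ {C D} → S C → C ≐ D → S D)
              (lits : List Lit) (S⊆lits : ∀ {C} → S C → C ⊆ᶜ lits) where

  NodeOK? : ∀ {n} (N : Fin n → Node n) i κ → Dec (NodeOK S N i κ)
  NodeOK? N i leaf        = S? (clause (N i))
  NodeOK? N i (res y j k) = (toℕ j ℕ.<? toℕ i) ×-dec ((toℕ k ℕ.<? toℕ i) ×-dec isResolvent? y _ _ _)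

  HasParent? : ∀ {n} (N : Fin n → Node n) i → Dec (HasParent N i)
  HasParent? N i = Finₚ.any? parentVia?
    where
    parentVia? : ∀ p → Dec (∃[ y ] ∃[ j ] ∃[ k ] (kind (N p) ≡ res y j k × (i ≡ j ⊎ i ≡ k)))
    parentVia? p with kind (N p)
    ... | leaf = no λ { (_ , _ , _ , () , _) }
    ... | res y j k with (i Finₚ.≟ j) ⊎-dec (i Finₚ.≟ k)
    ...   | yes child = yes (y , j , k , refl , child)
    ...   | no ¬child = no λ { (_ , _ , _ , refl , child) → ¬child child }

  walksUnique? : ∀ {n} (N : Fin n → Node n) → (∀ i → NodeOK S N i (kind (N i))) →
                 ∀ i pre → Dec (∀ vs → Walk N i vs → Unique (pre ++ vs))
  walksUnique? {n} N ok = <-rec _ step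
    where
    WalksUnique : Fin n → List Var → Set
    WalksUnique i pre = ∀ vs → Walk N i vs → Unique (pre ++ vs)
    step : ∀ i → (∀ {c : Fin n} → c Fin.< i → ∀ pre → Dec (WalksUnique c pre)) → ∀ pre → Dec (WalksUnique i pre)
    step i ih pre with kind (N i) in eq | ok i
    ... | leaf | _ = map′ (λ !pre vs w → subst (Unique ∘ (pre ++_)) (sym (Walk-leaf eq w)) !pre)
                          (λ unique → unique [] (stop eq)) (unique? (pre ++ []))
    ... | res y j k | j<i , k<i , _ = map′ viaChildren toChildren (ih j<i (pre ++ y ∷ []) ×-dec ih k<i (pre ++ y ∷ []))
      where
      reassoc : ∀ {vs} → Unique ((pre ++ y ∷ []) ++ vs) → Unique (pre ++ y ∷ vs)
      reassoc {vs} = subst Unique (++-assoc pre (y ∷ []) vs)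
      viaChildren : WalksUnique j (pre ++ y ∷ []) × WalksUnique k (pre ++ y ∷ []) → WalksUnique i pre
      viaChildren _ _ (stop e) with () ← trans (sym eq) e
      viaChildren (uj , _) _ (left e w)  with refl ← trans (sym eq) e = reassoc (uj _ w)
      viaChildren (_ , uk) _ (right e w) with refl ← trans (sym eq) e = reassoc (uk _ w)
      toChildren : WalksUnique i pre → WalksUnique j (pre ++ y ∷ []) × WalksUnique k (pre ++ y ∷ [])
      toChildren unique =
        (λ vs w → subst Unique (sym (++-assoc pre (y ∷ []) vs)) (unique (y ∷ vs) (left eq w))) ,
        (λ vs w → subst Unique (sym (++-assoc pre (y ∷ []) vs)) (unique (y ∷ vs) (right eq w)))

  IsRegularRefutation : ∀ m → (Fin (suc m) → Node (suc m)) → Set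
  IsRegularRefutation m N = (∀ i → NodeOK S N i (kind (N i))) × clause (N (fromℕ m)) ≡ [] ×
                            (∀ i → i ≢ fromℕ m → HasParent N i) × (∀ vs → Walk N (fromℕ m) vs → Unique vs)

  isRegularRefutation? : ∀ m N → Dec (IsRegularRefutation m N)
  isRegularRefutation? m N with Finₚ.all? (λ i → NodeOK? N i (kind (N i)))
  ... | no ¬ok = no (¬ok ∘ proj₁)
  ... | yes ok = map′ (ok ,_) proj₂
    (≡-dec _≟ˡ_ (clause (N (fromℕ m))) [] ×-dec
     Finₚ.all? (λ i → ¬? (i Finₚ.≟ fromℕ m) →-dec HasParent? N i) ×-dec
     walksUnique? N ok (fromℕ m) [])

  IsRegularRefutation-resp : ∀ m {N N′ : Fin (suc m) → Node (suc m)} → (∀ t → N t ≡ N′ t) →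
                             IsRegularRefutation m N → IsRegularRefutation m N′
  IsRegularRefutation-resp m {N} {N′} N≗N′ (ok , root-empty , connected , unique) =
    (λ i → subst (NodeOK S N′ i) (cong kind (N≗N′ i)) (NodeOK-resp i (kind (N i)) (ok i))) ,
    trans (cong clause (sym (N≗N′ (fromℕ m)))) root-empty ,
    (λ i i≢root → parent (connected i i≢root)) ,
    (λ vs w → unique vs (Walk-resp-kind (λ t → cong kind (sym (N≗N′ t))) w))
    where
    NodeOK-resp : ∀ i κ → NodeOK S N i κ → NodeOK S N′ i κ
    NodeOK-resp i leaf        o = subst S (cong clause (N≗N′ i)) o
    NodeOK-resp i (res y j k) (j<i , k<i , isRes) =
      j<i , k<i , subst₂ (λ Cj Ck → IsResolvent y Cj Ck (clause (N′ i))) (cong clause (N≗N′ j)) (cong clause (N≗N′ k))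
                          (subst (IsResolvent y _ _) (cong clause (N≗N′ i)) isRes)
    parent : ∀ {i} → HasParent N i → HasParent N′ i
    parent (p , y , j , k , e , child) = p , y , j , k , trans (cong kind (sym (N≗N′ p))) e , child

  clauses⊆lits : ∀ {n} (N : Fin n → Node n) → (∀ i → NodeOK S N i (kind (N i))) → ∀ i → clause (N i) ⊆ᶜ lits
  clauses⊆lits {n} N ok = <-rec _ step
    where
    step : ∀ i → (∀ {c : Fin n} → c Fin.< i → clause (N c) ⊆ᶜ lits) → clause (N i) ⊆ᶜ lits
    step i ih with kind (N i) | ok i
    ... | leaf      | isLeaf = S⊆lits isLeaf
    ... | res y j k | j<i , k<i , (_ , _ , sound , _) =
      λ l l∈ → [ ih j<i l ∘ proj₁ , ih k<i l ∘ proj₁ ]′ (sound l l∈)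

  -- Clauses are lists, so without normalisation there would be infinitely many tables of a given size.
  canonical : Clause → Clause
  canonical C = filter (_∈? C) lits

  canonical-≐ : ∀ {C} → C ⊆ᶜ lits → canonical C ≐ C
  canonical-≐ {C} C⊆lits =
    (λ _ l∈ → proj₂ (∈-filter⁻ (_∈? C) {xs = lits} l∈)) , (λ l l∈ → ∈-filter⁺ (_∈? _) (C⊆lits l l∈) l∈)

  canonical-[] : canonical [] ≡ []
  canonical-[] = filter-none (_∈? []) {xs = lits} (All.tabulate λ _ ())

  candidateKinds : ∀ k → List (Kind k)
  candidateKinds k =
    leaf ∷ map (λ (y , j , j′) → res y j j′) (cartesianProduct (map var lits) (cartesianProduct (allFin k) (allFin k)))

  candidateNodes : ∀ k → List (Node k)
  candidateNodes k = map (uncurry node) (cartesianProduct (sublists lits) (candidateKinds k))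

  module Canonicalise (P : Proof S) (regular : Regular P) where

    canonicalNodes : Fin (size P) → Node (size P)
    canonicalNodes t = node (canonical (clause (nodes P t))) (kind (nodes P t))

    private
      ⊆lits = clauses⊆lits (nodes P) (ok P)

    canonicalNodes-candidates : ∀ t → canonicalNodes t ∈ candidateNodes (size P)
    canonicalNodes-candidates t = ∈-map⁺ (uncurry node) (∈-cartesianProduct⁺ (filter-∈-sublists _ lits) kind∈)
      where
      kind∈ : kind (nodes P t) ∈ candidateKinds (size P)
      kind∈ with kind (nodes P t) | ok P t
      ... | leaf      | _ = here refl
      ... | res y j k | (_ , _ , py∈ , _) =
        there (∈-map⁺ _ (∈-cartesianProduct⁺ (∈-map⁺ var (⊆lits j (pos y) py∈))
                           (∈-cartesianProduct⁺ (∈-allFin j) (∈-allFin k))))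

    canonicalNodes-ok : ∀ i → NodeOK S canonicalNodes i (kind (canonicalNodes i))
    canonicalNodes-ok i with kind (nodes P i) | ok P i
    ... | leaf      | isLeaf = S-resp-≐ isLeaf (≐-sym (canonical-≐ (⊆lits i)))
    ... | res y j k | j<i , k<i , isRes =
      j<i , k<i , IsResolvent-resp-≐ isRes (≐-sym (canonical-≐ (⊆lits j))) (≐-sym (canonical-≐ (⊆lits k)))
                                            (≐-sym (canonical-≐ (⊆lits i)))

    canonicalNodes-isRegularRefutation : IsRegularRefutation (m P) canonicalNodes
    canonicalNodes-isRegularRefutation =
      canonicalNodes-ok , trans (cong canonical (root-empty P)) canonical-[] , connected P ,
      (λ vs w → regular vs (Walk⇒Path P (Walk-resp-kind (λ _ → refl) w)))

  regularOfSize? : ∀ k → Dec (Σ[ P ∈ Proof S ] (Regular P × size P ≡ k))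
  regularOfSize? zero    = no λ { (_ , _ , ()) }
  regularOfSize? (suc m) =
    map′ fromTable toTable (∃-vector? (candidateNodes (suc m)) (suc m) (IsRegularRefutation m)
                                      (isRegularRefutation? m) (IsRegularRefutation-resp m))
    where
    fromTable : _ → Σ[ P ∈ Proof S ] (Regular P × size P ≡ suc m)
    fromTable (N , _ , ok , root-empty , connected , unique) =
      record { m = m ; nodes = N ; ok = ok ; root-empty = root-empty ; connected = connected } ,
      (λ vs w → unique vs (Path⇒Walk _ w)) , refl
    toTable : Σ[ P ∈ Proof S ] (Regular P × size P ≡ suc m) → _
    toTable (P , regular , refl) =
      let open Canonicalise P regular
      in canonicalNodes , canonicalNodes-candidates , canonicalNodes-isRegularRefutation

-- Existence of regular refutations

∈-∷-complement : ∀ {a ρ l} → complement l ∈ a ∷ ρ → l ≢ complement a → complement l ∈ ρ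
∈-∷-complement {a} {l = l} (here ¬l≡a) l≢¬a =
  ⊥-elim (l≢¬a (trans (sym (complement-involutive l)) (cong complement ¬l≡a)))
∈-∷-complement (there ¬l∈ρ) _ = ¬l∈ρ

Falsifies : List Lit → Clause → Set
Falsifies ρ C = ∀ l → l ∈ C → complement l ∈ ρ

-- Tables built by prepending nodes, so that the children of a node have larger indices.
NodeOKʳ : ∀ {n} → ClauseSet → (Fin n → Node n) → Fin n → Kind n → Set
NodeOKʳ S N i leaf        = S (clause (N i))
NodeOKʳ S N i (res y j k) = toℕ i < toℕ j × toℕ i < toℕ k × IsResolvent y (clause (N j)) (clause (N k)) (clause (N i))

shiftKind : ∀ {n} → Kind n → Kind (suc n)
shiftKind leaf        = leaf
shiftKind (res y j k) = res y (fs j) (fs k)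

prepend : ∀ {n} → Node (suc n) → (Fin n → Node n) → Fin (suc n) → Node (suc n)
prepend nd N fz     = nd
prepend nd N (fs t) = node (clause (N t)) (shiftKind (kind (N t)))

prepend-ok : ∀ {S n} (nd : Node (suc n)) (N : Fin n → Node n) → NodeOKʳ S (prepend nd N) fz (kind nd) →
             (∀ i → NodeOKʳ S N i (kind (N i))) → ∀ i → NodeOKʳ S (prepend nd N) i (kind (prepend nd N i))
prepend-ok nd N ok₀ ok fz         = ok₀
prepend-ok {S} nd N ok₀ ok (fs t) = shift (kind (N t)) (ok t)
  where
  shift : ∀ κ → NodeOKʳ S N t κ → NodeOKʳ S (prepend nd N) (fs t) (shiftKind κ)
  shift leaf        o                   = o
  shift (res y j k) (t<j , t<k , isRes) = s≤s t<j , s≤s t<k , isRes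

Walk-prepend : ∀ {n} {nd : Node (suc n)} {N : Fin n → Node n} {t us} → Walk (prepend nd N) (fs t) us → Walk N t us
Walk-prepend {N = N} {t} (stop e) with kind (N t) in eq | e
... | leaf | _ = stop eq
Walk-prepend {N = N} {t} (left e w) with kind (N t) in eq | e
... | res y j k | refl = left eq (Walk-prepend w)
Walk-prepend {N = N} {t} (right e w) with kind (N t) in eq | e
... | res y j k | refl = right eq (Walk-prepend w)

module Reverse {S : ClauseSet} {n} (N : Fin n → Node n) (ok : ∀ i → NodeOKʳ S N i (kind (N i))) where

  reverseKind : Kind n → Kind n
  reverseKind leaf        = leaf
  reverseKind (res y j k) = res y (opposite j) (opposite k)

  reversed : Fin n → Node n
  reversed i = node (clause (N (opposite i))) (reverseKind (kind (N (opposite i))))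

  opposite-< : ∀ {a b : Fin n} → toℕ a < toℕ b → toℕ (opposite b) < toℕ (opposite a)
  opposite-< {a} {b} a<b rewrite Finₚ.opposite-prop a | Finₚ.opposite-prop b = ℕₚ.∸-monoʳ-< (s≤s a<b) (Finₚ.toℕ<n b)

  reversed-ok : ∀ i → NodeOK S reversed i (kind (reversed i))
  reversed-ok i = reverseOK (kind (N (opposite i))) (ok (opposite i))
    where
    reverseOK : ∀ κ → NodeOKʳ S N (opposite i) κ → NodeOK S reversed i (reverseKind κ)
    reverseOK leaf        o                   = o
    reverseOK (res y j k) (i<j , i<k , isRes) =
      subst (λ z → toℕ (opposite j) < toℕ z) (Finₚ.opposite-involutive i) (opposite-< i<j) ,
      subst (λ z → toℕ (opposite k) < toℕ z) (Finₚ.opposite-involutive i) (opposite-< i<k) ,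
      subst₂ (λ Cj Ck → IsResolvent y Cj Ck (clause (N (opposite i))))
        (cong (clause ∘ N) (sym (Finₚ.opposite-involutive j)))
        (cong (clause ∘ N) (sym (Finₚ.opposite-involutive k))) isRes

  Walk-reversed : ∀ {i us} → Walk reversed i us → Walk N (opposite i) us
  Walk-reversed {i} (stop e) with kind (N (opposite i)) in eq | e
  ... | leaf | _ = stop eq
  Walk-reversed {i} (left e w) with kind (N (opposite i)) in eq | e
  ... | res y j k | refl = left eq (subst (λ z → Walk N z _) (Finₚ.opposite-involutive j) (Walk-reversed w))
  Walk-reversed {i} (right e w) with kind (N (opposite i)) in eq | e
  ... | res y j k | refl = right eq (subst (λ z → Walk N z _) (Finₚ.opposite-involutive k) (Walk-reversed w))

-- Splitting on the variables of lits one after another yields a tree-like regular refutation.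
module Completeness (S : ClauseSet) (Cs : List Clause) (Cs⊆S : ∀ {C} → C ∈ Cs → S C)
                    (unsat : Unsatisfiable (_∈ Cs)) (lits : List Lit) (Cs⊆lits : ∀ {C} → C ∈ Cs → C ⊆ᶜ lits) where

  Cover : List Var → List Lit → Set
  Cover vs ρ = ∀ l → l ∈ lits → var l ∈ vs ⊎ l ∈ ρ ⊎ complement l ∈ ρ

  cover-∷ : ∀ {y vs ρ} b → Cover (y ∷ vs) ρ → Cover vs (lit y b ∷ ρ)
  cover-∷ {y} {vs} {ρ} b cover l l∈ = extended l (cover l l∈)
    where
    extended : ∀ l → var l ∈ y ∷ vs ⊎ l ∈ ρ ⊎ complement l ∈ ρ → var l ∈ vs ⊎ l ∈ lit y b ∷ ρ ⊎ complement l ∈ lit y b ∷ ρ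
    extended l (inj₁ (there v∈))     = inj₁ v∈
    extended l (inj₂ (inj₁ l∈ρ))     = inj₂ (inj₁ (there l∈ρ))
    extended l (inj₂ (inj₂ ¬l∈ρ))    = inj₂ (inj₂ (there ¬l∈ρ))
    extended (lit .y p) (inj₁ (here refl)) with p ≟ᵇ b
    ... | yes refl = inj₂ (inj₁ (here refl))
    ... | no p≢b   = inj₂ (inj₂ (here (cong (lit y) (sym (¬-not (≢-sym p≢b))))))

  record Extension (vs : List Var) (ρ : List Lit) {n} (N : Fin n → Node n) : Set where
    field
      n⁺            : ℕ
      N⁺            : Fin n⁺ → Node n⁺
      ok⁺           : ∀ i → NodeOKʳ S N⁺ i (kind (N⁺ i))
      embed         : Fin n → Fin n⁺
      embed-clause  : ∀ t → clause (N⁺ (embed t)) ≡ clause (N t)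
      embed-walk    : ∀ t us → Walk N⁺ (embed t) us → Walk N t us
      top           : Fin n⁺
      top-falsified : Falsifies ρ (clause (N⁺ top))
      top-walks     : ∀ us → Walk N⁺ top us → Unique us × (∀ u → u ∈ us → u ∈ vs)

  falsifiedInput : ∀ ρ → Cover [] ρ → ∀ {n} (N : Fin n → Node n) → (∀ i → NodeOKʳ S N i (kind (N i))) → Extension [] ρ N
  falsifiedInput ρ cover N ok with ∃∈? (∀∈? (λ l → complement l ∈? ρ)) Cs
  ... | yes (C , C∈ , falsified) = record
    { n⁺ = _ ; N⁺ = prepend (node C leaf) N ; ok⁺ = prepend-ok _ N (Cs⊆S C∈) ok
    ; embed = fs ; embed-clause = λ _ → refl ; embed-walk = λ _ _ → Walk-prepend
    ; top = fz ; top-falsified = falsified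
    ; top-walks = λ us w → subst (λ us → Unique us × (∀ u → u ∈ us → u ∈ [])) (sym (Walk-leaf refl w)) ([] , λ _ ()) }
  ... | no none = ⊥-elim (unsat (α , α⊨Cs))
    where
    α : Assignment
    α v = isYes (pos v ∈? ρ)
    α⊨ : ∀ l → l ∈ ρ → complement l ∉ ρ → α ⊨ˡ l
    α⊨ (lit v true)  l∈ρ _ with pos v ∈? ρ
    ... | yes _    = refl
    ... | no l∉ρ   = ⊥-elim (l∉ρ l∈ρ)
    α⊨ (lit v false) _ ¬l∉ρ with pos v ∈? ρ
    ... | yes ¬l∈ρ = ⊥-elim (¬l∉ρ ¬l∈ρ)
    ... | no _     = refl
    α⊨Cs : ∀ C → C ∈ Cs → α ⊨ᶜ C
    α⊨Cs C C∈ with ∃∈? (λ l → ¬? (complement l ∈? ρ)) C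
    ... | no all-falsified =
      ⊥-elim (none (C , C∈ , λ l l∈ → decidable-stable (complement l ∈? ρ) (λ ¬l∉ρ → all-falsified (l , l∈ , ¬l∉ρ))))
    ... | yes (l , l∈C , ¬l∉ρ) with cover l (Cs⊆lits C∈ l l∈C)
    ...   | inj₂ (inj₁ l∈ρ)  = lose l∈C (α⊨ l l∈ρ ¬l∉ρ)
    ...   | inj₂ (inj₂ ¬l∈ρ) = ⊥-elim (¬l∉ρ ¬l∈ρ)

  extend : ∀ vs ρ → Unique vs → Cover vs ρ → ∀ {n} (N : Fin n → Node n) → (∀ i → NodeOKʳ S N i (kind (N i))) →
           Extension vs ρ N
  extend []       ρ _            cover N ok = falsifiedInput ρ cover N ok
  extend (y ∷ vs) ρ (y∉vs ∷ !vs) cover N ok = combine (neg y ∈? D₁) (pos y ∈? D₀)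
    where
    E₁ = extend vs (pos y ∷ ρ) !vs (cover-∷ true cover) N ok
    module E₁ = Extension E₁
    E₂ = extend vs (neg y ∷ ρ) !vs (cover-∷ false cover) E₁.N⁺ E₁.ok⁺
    module E₂ = Extension E₂
    D₁ = clause (E₁.N⁺ E₁.top)
    D₀ = clause (E₂.N⁺ E₂.top)
    top₁ = E₂.embed E₁.top
    D₁≡ : clause (E₂.N⁺ top₁) ≡ D₁
    D₁≡ = E₂.embed-clause E₁.top
    widen : ∀ {us} → (∀ u → u ∈ us → u ∈ vs) → ∀ u → u ∈ us → u ∈ y ∷ vs
    widen us⊆vs u = there ∘ us⊆vs u
    combine : Dec (neg y ∈ D₁) → Dec (pos y ∈ D₀) → Extension (y ∷ vs) ρ N
    combine (no ny∉D₁) _ = record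
      { n⁺ = E₂.n⁺ ; N⁺ = E₂.N⁺ ; ok⁺ = E₂.ok⁺ ; embed = E₂.embed ∘ E₁.embed
      ; embed-clause = λ t → trans (E₂.embed-clause (E₁.embed t)) (E₁.embed-clause t)
      ; embed-walk = λ t us → E₁.embed-walk t us ∘ E₂.embed-walk _ us
      ; top = top₁
      ; top-falsified = λ l l∈ → let l∈D₁ = subst (l ∈_) D₁≡ l∈
                                 in ∈-∷-complement (E₁.top-falsified l l∈D₁) λ { refl → ny∉D₁ l∈D₁ }
      ; top-walks = λ us w → map₂ widen (E₁.top-walks us (E₂.embed-walk _ us w)) }
    combine (yes _) (no py∉D₀) = record
      { n⁺ = E₂.n⁺ ; N⁺ = E₂.N⁺ ; ok⁺ = E₂.ok⁺ ; embed = E₂.embed ∘ E₁.embed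
      ; embed-clause = λ t → trans (E₂.embed-clause (E₁.embed t)) (E₁.embed-clause t)
      ; embed-walk = λ t us → E₁.embed-walk t us ∘ E₂.embed-walk _ us
      ; top = E₂.top
      ; top-falsified = λ l l∈ → ∈-∷-complement (E₂.top-falsified l l∈) λ { refl → py∉D₀ l∈ }
      ; top-walks = λ us w → map₂ widen (E₂.top-walks us w) }
    combine (yes ny∈D₁) (yes py∈D₀) = record
      { n⁺ = suc E₂.n⁺ ; N⁺ = N₃ ; ok⁺ = prepend-ok resolution E₂.N⁺ ok₀ E₂.ok⁺ ; embed = fs ∘ E₂.embed ∘ E₁.embed
      ; embed-clause = λ t → trans (E₂.embed-clause (E₁.embed t)) (E₁.embed-clause t)
      ; embed-walk = λ t us → E₁.embed-walk t us ∘ E₂.embed-walk _ us ∘ Walk-prepend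
      ; top = fz
      ; top-falsified = falsified
      ; top-walks = walks }
      where
      resolution : Node (suc E₂.n⁺)
      resolution = node (resolvent y D₀ D₁) (res y (fs E₂.top) (fs top₁))
      N₃ = prepend resolution E₂.N⁺
      ok₀ : NodeOKʳ S N₃ fz (kind resolution)
      ok₀ = s≤s z≤n , s≤s z≤n ,
            subst (λ D → IsResolvent y D₀ D (resolvent y D₀ D₁)) (sym D₁≡) (resolvent-isResolvent py∈D₀ ny∈D₁)
      falsified : Falsifies ρ (resolvent y D₀ D₁)
      falsified l l∈ with ∈-++⁻ (remove (pos y) D₀) l∈
      ... | inj₁ l∈D₀′ = let l∈D₀ , l≢ = ∈-remove⁻ D₀ l∈D₀′ in ∈-∷-complement (E₂.top-falsified l l∈D₀) l≢
      ... | inj₂ l∈D₁′ = let l∈D₁ , l≢ = ∈-remove⁻ D₁ l∈D₁′ in ∈-∷-complement (E₁.top-falsified l l∈D₁) l≢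
      cons : ∀ {us} → Unique us × (∀ u → u ∈ us → u ∈ vs) → Unique (y ∷ us) × (∀ u → u ∈ y ∷ us → u ∈ y ∷ vs)
      cons (!us , us⊆vs) = (All.tabulate (All.lookup y∉vs ∘ us⊆vs _) ∷ !us) ,
                           λ { u (here refl) → here refl ; u (there u∈) → there (us⊆vs u u∈) }
      walks : ∀ us → Walk N₃ fz us → Unique us × (∀ u → u ∈ us → u ∈ y ∷ vs)
      walks _ (stop ())
      walks _ (left refl w)  = cons (E₂.top-walks _ (Walk-prepend w))
      walks _ (right refl w) = cons (E₁.top-walks _ (E₂.embed-walk _ _ (Walk-prepend w)))

  regularRefutation : Σ (Proof S) Regular
  regularRefutation = P , regular
    where
    vs = deduplicate ℕ._≟_ (map var lits)
    -- opaque: otherwise type checking unfolds the whole construction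
    opaque
      E : Extension vs [] {0} (λ ())
      E = extend vs [] (deduplicate-! (map var lits)) (λ l l∈ → inj₁ (∈-deduplicate⁺ ℕ._≟_ (∈-map⁺ var l∈))) (λ ()) (λ ())
    module E = Extension E
    open Reverse {S} E.N⁺ E.ok⁺
    top-empty : clause (E.N⁺ E.top) ≡ []
    top-empty = ⊆ᶜ[]⇒≡[] _ (λ l l∈ → case E.top-falsified l l∈ of λ ())
    pruned = prune E.n⁺ reversed reversed-ok (opposite E.top)
               (trans (cong (clause ∘ E.N⁺) (Finₚ.opposite-involutive E.top)) top-empty)
               (const true) refl (λ _ _ _ _ _ _ → refl , refl) {Q = λ _ → ⊥} {c₁ = []} {c₂ = []} (λ { _ _ _ _ () _ })
    P = proj₁ pruned
    regular : Regular P
    regular vs w =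
      let w′ = proj₁ (proj₂ (proj₂ pruned)) vs (Path⇒Walk P w)
      in proj₁ (E.top-walks vs (subst (λ z → Walk E.N⁺ z vs) (Finₚ.opposite-involutive E.top) (Walk-reversed w′)))

module _ (F : CNF) (γ : Clause) (x : Var) where

  private
    S = g x F γ

  g-resp-≐ : ∀ {C D} → S C → C ≐ D → S D
  g-resp-≐ (inj₁ C≐x)                     C≐D = inj₁ (≐-trans (≐-sym C≐D) C≐x)
  g-resp-≐ (inj₂ (inj₁ C≐¬xγ))            C≐D = inj₂ (inj₁ (≐-trans (≐-sym C≐D) C≐¬xγ))
  g-resp-≐ (inj₂ (inj₂ (E , E∈F , E≉γ , C≐E))) C≐D = inj₂ (inj₂ (E , E∈F , E≉γ , ≐-trans (≐-sym C≐D) C≐E))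

  g? : ∀ C → Dec (S C)
  g? C = (C ≐? (pos x ∷ [])) ⊎-dec (C ≐? (neg x ∷ γ)) ⊎-dec
         map′ (λ (D , D∈F , D≉γ , C≐D) → D , D∈F , D≉γ , C≐D) (λ (D , D∈F , D≉γ , C≐D) → D , D∈F , D≉γ , C≐D)
              (∃∈? (λ D → ¬? (D ≐? γ) ×-dec (C ≐? D)) F)

  gLits : List Lit
  gLits = pos x ∷ neg x ∷ γ ++ concat F

  g⊆gLits : ∀ {C} → S C → C ⊆ᶜ gLits
  g⊆gLits (inj₁ (C⊆x , _)) l l∈ with C⊆x l l∈
  ... | here refl = here refl
  g⊆gLits (inj₂ (inj₁ (C⊆¬xγ , _))) l l∈ with C⊆¬xγ l l∈
  ... | here refl = there (here refl)
  ... | there l∈γ = there (there (∈-++⁺ˡ l∈γ))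
  g⊆gLits (inj₂ (inj₂ (D , D∈F , _ , C⊆D , _))) l l∈ = there (there (∈-++⁺ʳ γ (∈-concat⁺′ (C⊆D l l∈) D∈F)))

  gClauses : List Clause
  gClauses = (pos x ∷ []) ∷ (neg x ∷ γ) ∷ filter (λ D → ¬? (D ≐? γ)) F

  gClauses⊆g : ∀ {C} → C ∈ gClauses → S C
  gClauses⊆g (here refl)         = inj₁ ≐-refl
  gClauses⊆g (there (here refl)) = inj₂ (inj₁ ≐-refl)
  gClauses⊆g (there (there C∈))  = let C∈F , C≉γ = ∈-filter⁻ (λ D → ¬? (D ≐? γ)) {xs = F} C∈
                                    in inj₂ (inj₂ (_ , C∈F , C≉γ , ≐-refl))

  -- A model of g x F γ makes x true, hence satisfies γ through ¬x ∨ γ.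
  gClauses-unsat : Unsatisfiable ⟦ F ⟧ → Unsatisfiable (_∈ gClauses)
  gClauses-unsat unsat (α , α⊨) = unsat (α , α⊨F)
    where
    α⊨F : ∀ C → ⟦ F ⟧ C → α ⊨ᶜ C
    α⊨F C (D , D∈F , C≐D) with D ≐? γ
    ... | no D≉γ = ⊨ᶜ-mono (proj₂ C≐D) (α⊨ D (there (there (∈-filter⁺ (λ D → ¬? (D ≐? γ)) D∈F D≉γ))))
    ... | yes D≐γ with α⊨ _ (here refl) | α⊨ _ (there (here refl))
    ...   | here αx | here α¬x with () ← trans (sym αx) α¬x
    ...   | here _  | there α⊨γ = ⊨ᶜ-mono (λ l → proj₂ C≐D l ∘ proj₂ D≐γ l) α⊨γ

  optimalRegularRefutation : Unsatisfiable ⟦ F ⟧ → Σ (Proof S) OptimalRegular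
  optimalRegularRefutation unsat
    with least (λ k → Σ[ P ∈ Proof S ] (Regular P × size P ≡ k)) regularOfSize? (size P₀) (P₀ , regular₀ , refl)
    where
    open Completeness S gClauses gClauses⊆g (gClauses-unsat unsat) gLits (g⊆gLits ∘ gClauses⊆g)
    open Search S g? g-resp-≐ gLits g⊆gLits
    P₀ = proj₁ regularRefutation
    regular₀ = proj₂ regularRefutation
  ... | _ , (P , regular , refl) , minimal = P , regular , λ Q regularQ → minimal (size Q) (Q , regularQ , refl)

lemma7 : (F : CNF) (γ : Clause) (x : Var) →
    Unsatisfiable ⟦ F ⟧ → γ ∈ F → Satisfiable (F ∖ γ) → NotIn x F →
    ((P : Proof (g x F γ)) → OptimalRegular P → ExactlyOneResOn P x)
    × (Σ[ P ∈ Proof (g x F γ) ] (OptimalRegular P × ExactlyOneResOn P x ×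
         (∃[ i ] ∃[ j ] ∃[ k ] (kind (nodes P i) ≡ res x j k ×
            IsLeaf P j × IsLeaf P k ×
            clause (nodes P j) ≐ (pos x ∷ []) × clause (nodes P k) ≐ (neg x ∷ γ)))))
lemma7 F γ x unsat γ∈F sat x∉F =
  optimal⇒exactlyOneResOn F γ x γ∈F sat x∉F ,
  uncurry (optimal⇒optimalWithLeafStep F γ x γ∈F sat x∉F) (optimalRegularRefutation F γ x unsat)
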